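{- There is an absolute constant $c>0$ such that if $m\ge c\, n^{4.41}$, then the binary tree algorithm described below incurs $O(1)$ inversions in expectation.
   Context: Secretary ranking problem: $n$ elements with distinct values from a totally ordered set arrive online in uniformly random order; at time $t$ the algorithm knows only comparisons among the elements arrived so far and irrevocably assigns the arriving element a free position in $[m]$; an inversion is a pair of elements whose positions are in the opposite order to their true order. Binary tree algorithm: take a complete binary tree of height $\bar h$, the largest integer with $2^{\bar h+1}-1\le m$, and associate distinct positions to its nodes so that each node's position is larger than all positions in its left subtree and smaller than all positions in its right subtree. Arriving elements are inserted one by one into this tree as into a binary search tree, and each element is placed at the position of the node it occupies; if some element would need to be inserted at depth exceeding $\bar h$, from then on elements are allocated to free positions arbitrarily. Expectation is over the arrival order. -}

module Defs where

open import Data.Nat using (ℕ; zero; suc; _+_; _*_; _^_; _≤_; _<_; _<ᵇ_; _≤ᵇ_)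
open import Data.Bool using (Bool; true; false; if_then_else_; _∧_; _∨_)
open import Data.List using (List; []; _∷_; _++_; [_]; length; map; concatMap; zip)
open import Data.List.Membership.Propositional using (_∉_)
open import Data.Product using (_×_; _,_)

-- Arrival orders: all permutations of the elements 0,…,n-1 (the element
-- with value i is the (i+1)-st smallest).  Each permutation occurs exactly once.
insertions : ℕ → List ℕ → List (List ℕ)
insertions x []       = (x ∷ []) ∷ []
insertions x (y ∷ ys) = (x ∷ y ∷ ys) ∷ map (y ∷_) (insertions x ys)

perms : ℕ → List (List ℕ)
perms zero    = [] ∷ []
perms (suc n) = concatMap (insertions n) (perms n)

-- Binary search trees and insertion; insertPath returns the new tree and the
-- path (false = left, true = right) from the root to the new node.
data BST : Set where
  leaf : BST
  node : BST → ℕ → BST → BST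

insertPath : ℕ → BST → BST × List Bool
insertPath x leaf = node leaf x leaf , []
insertPath x (node l y r) with x <ᵇ y
... | true  with insertPath x l
...   | l′ , p = node l′ y r , false ∷ p
insertPath x (node l y r) | false with insertPath x r
...   | r′ , p = node l y r′ , true ∷ p

-- What an online algorithm knows about the arrived elements: their relative
-- ranks (in arrival order).
rankIn : ℕ → List ℕ → ℕ
rankIn x []       = 0
rankIn x (y ∷ ys) = (if y <ᵇ x then 1 else 0) + rankIn x ys

pattern′ : List ℕ → List ℕ
pattern′ xs = map (λ x → rankIn x xs) xs

-- A fallback (arbitrary) allocation rule: given the relative-rank pattern of
-- the arrived elements (current one last) and the positions already used
-- (in arrival order), it returns a position.
Fallback : Set
Fallback = List ℕ → List ℕ → ℕ

ValidFallback : ℕ → Fallback → Set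
ValidFallback m F = ∀ pat ps → length ps < m → (F pat ps < m) × (F pat ps ∉ ps)

-- Node positions: tree nodes are paths (List Bool) of length ≤ h.
ValidTreePositions : ℕ → ℕ → (List Bool → ℕ) → Set
ValidTreePositions m h pos =
  (∀ p → length p ≤ h → pos p < m) ×
  (∀ p q → length (p ++ false ∷ q) ≤ h → pos (p ++ false ∷ q) < pos p) ×
  (∀ p q → length (p ++ true ∷ q) ≤ h → pos p < pos (p ++ true ∷ q))

-- The binary tree algorithm: tree, failure flag, arrived elements, positions
-- used so far, remaining arrivals ↦ positions of all elements (arrival order).
runBT : ℕ → (List Bool → ℕ) → Fallback →
        BST → Bool → List ℕ → List ℕ → List ℕ → List ℕ
runBT h pos F t fl arr ps [] = ps
runBT h pos F t true arr ps (x ∷ xs) =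
  runBT h pos F t true (arr ++ [ x ]) (ps ++ [ F (pattern′ (arr ++ [ x ])) ps ]) xs
runBT h pos F t false arr ps (x ∷ xs) with insertPath x t
... | t′ , p with length p ≤ᵇ h
...   | true  = runBT h pos F t′ false (arr ++ [ x ]) (ps ++ [ pos p ]) xs
...   | false = runBT h pos F t true (arr ++ [ x ])
                  (ps ++ [ F (pattern′ (arr ++ [ x ])) ps ]) xs

binaryTreeAlg : ℕ → (List Bool → ℕ) → Fallback → List ℕ → List (ℕ × ℕ)
binaryTreeAlg h pos F σ = zip σ (runBT h pos F leaf false [] [] σ)

isInv : ℕ × ℕ → ℕ × ℕ → Bool
isInv (x , p) (y , q) = ((x <ᵇ y) ∧ (q <ᵇ p)) ∨ ((y <ᵇ x) ∧ (p <ᵇ q))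

countInv : ℕ × ℕ → List (ℕ × ℕ) → ℕ
countInv a []       = 0
countInv a (b ∷ bs) = (if isInv a b then 1 else 0) + countInv a bs

inversions : List (ℕ × ℕ) → ℕ
inversions []       = 0
inversions (a ∷ as) = countInv a as + inversions as

sumℕ : List ℕ → ℕ
sumℕ []       = 0
sumℕ (x ∷ xs) = x + sumℕ xs

-- Total number of inversions over all n! arrival orders
-- (expectation = this total divided by n!).
totalInversions : ℕ → ℕ → (List Bool → ℕ) → Fallback → ℕ
totalInversions n h pos F = sumℕ (map (λ σ → inversions (binaryTreeAlg h pos F σ)) (perms n))

module Submission where

-- If the binary search tree of the arrival order has no node at depth h + 1, every element sits at
-- the position of its node, positions follow the in-order of the tree, and there are no inversions;
-- otherwise there are at most n² of them. So the expectation is at most n² times the expected number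
-- of nodes at depth D = h + 1 of a random binary search tree. Splitting at the root (the first
-- arrival) gives a recurrence for this depth profile, whence
--   E[#nodes at depth D] ≤ (2q / (q + p))^D · ∏_{2 ≤ j ≤ n} (1 + p / (q j)) ≤ (2q / (q + p))^D · n^(p/q)
-- by weighted AM–GM. For p/q = 5.35 and 2^D ≥ n^4.41 (from m ≥ c n^4.41) this is at most n^(-2),
-- because log₂(127/40) ≥ 5/3 and 4.41 · 5/3 = 2 + 5.35.

open import Defs
open import Data.Nat using (ℕ; zero; suc; _+_; _*_; _^_; _≤_; _<_; _∸_; _!; z≤n; s≤s; _<ᵇ_; _≤ᵇ_; _<?_; _≤?_;
                            _/_; _%_; NonZero; >-nonZero; >-nonZero⁻¹)
open import Data.Nat.Properties
open import Data.Nat.DivMod using (m≡m%n+[m/n]*n; m%n<n; m/n*n≤m)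
open import Data.Nat.Combinatorics.Base using (_P′_)
open import Data.Nat.Combinatorics.Specification using (nP′n≡n!; nP′k≡n[n∸1P′k∸1])
open import Data.Nat.Tactic.RingSolver using (solve-∀)
import Algebra.Properties.CommutativeSemigroup *-commutativeSemigroup as *-CS
import Algebra.Properties.CommutativeSemigroup +-commutativeSemigroup as +-CS
open import Data.Bool using (Bool; true; false; if_then_else_; not; T)
open import Data.List using (List; []; _∷_; _++_; [_]; length; map; concatMap; filterᵇ; zip)
open import Data.List.Properties
  using (length-map; length-zipWith; ++-assoc; ++-identityʳ; map-++; map-∘; map-cong; map-id; map-id-local;
         filter-all; filter-none; filter-reject)
open import Data.List.Relation.Unary.All as All using (All; []; _∷_)
open import Data.List.Relation.Unary.All.Properties using (++⁺; concat⁺; map⁺)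
open import Data.List.Relation.Binary.Pointwise as Pointwise using (Pointwise; []; _∷_)
open import Data.Product using (Σ; _×_; _,_)
open import Data.Empty using (⊥-elim)
open import Data.Unit using (tt)
open import Function using (id; _∘_; it)
open import Relation.Binary.PropositionalEquality hiding ([_])
open import Relation.Nullary using (¬_; yes; no)
open import Relation.Nullary.Decidable using (T?)

sumOf : {A : Set} → (A → ℕ) → List A → ℕ
sumOf f xs = sumℕ (map f xs)

sumOf-++ : {A : Set} (f : A → ℕ) (xs ys : List A) → sumOf f (xs ++ ys) ≡ sumOf f xs + sumOf f ys
sumOf-++ f [] ys = refl
sumOf-++ f (x ∷ xs) ys = trans (cong (f x +_) (sumOf-++ f xs ys)) (sym (+-assoc (f x) _ _))

sumOf-concatMap : {A B : Set} (f : B → ℕ) (g : A → List B) (xs : List A) →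
  sumOf f (concatMap g xs) ≡ sumOf (λ x → sumOf f (g x)) xs
sumOf-concatMap f g [] = refl
sumOf-concatMap f g (x ∷ xs) =
  trans (sumOf-++ f (g x) (concatMap g xs)) (cong (sumOf f (g x) +_) (sumOf-concatMap f g xs))

sumOf-map : {A B : Set} (f : B → ℕ) (g : A → B) (xs : List A) → sumOf f (map g xs) ≡ sumOf (λ x → f (g x)) xs
sumOf-map f g [] = refl
sumOf-map f g (x ∷ xs) = cong (f (g x) +_) (sumOf-map f g xs)

sumOf-+ : {A : Set} (f g : A → ℕ) (xs : List A) → sumOf (λ x → f x + g x) xs ≡ sumOf f xs + sumOf g xs
sumOf-+ f g [] = refl
sumOf-+ f g (x ∷ xs) = trans (cong (f x + g x +_) (sumOf-+ f g xs)) (+-CS.interchange (f x) (g x) _ _)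

sumOf-* : {A : Set} (c : ℕ) (f : A → ℕ) (xs : List A) → sumOf (λ x → c * f x) xs ≡ c * sumOf f xs
sumOf-* c f [] = sym (*-zeroʳ c)
sumOf-* c f (x ∷ xs) = trans (cong (c * f x +_) (sumOf-* c f xs)) (sym (*-distribˡ-+ c (f x) _))

sumOf-const : {A : Set} (c : ℕ) (xs : List A) → sumOf (λ _ → c) xs ≡ length xs * c
sumOf-const c [] = refl
sumOf-const c (x ∷ xs) = cong (c +_) (sumOf-const c xs)

sumOf-cong : {A : Set} {P : A → Set} (f g : A → ℕ) {xs : List A} → All P xs →
  (∀ x → P x → f x ≡ g x) → sumOf f xs ≡ sumOf g xs
sumOf-cong f g [] f≡g = refl
sumOf-cong f g (px ∷ pxs) f≡g = cong₂ _+_ (f≡g _ px) (sumOf-cong f g pxs f≡g)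

sumOf-mono : {A : Set} {P : A → Set} (f g : A → ℕ) {xs : List A} → All P xs →
  (∀ x → P x → f x ≤ g x) → sumOf f xs ≤ sumOf g xs
sumOf-mono f g [] f≤g = z≤n
sumOf-mono f g (px ∷ pxs) f≤g = +-mono-≤ (f≤g _ px) (sumOf-mono f g pxs f≤g)

sumBelow : ℕ → (ℕ → ℕ) → ℕ
sumBelow zero f = 0
sumBelow (suc n) f = f n + sumBelow n f

sumBelow-cong : ∀ n (f g : ℕ → ℕ) → (∀ i → i < n → f i ≡ g i) → sumBelow n f ≡ sumBelow n g
sumBelow-cong zero f g f≡g = refl
sumBelow-cong (suc n) f g f≡g =
  cong₂ _+_ (f≡g n ≤-refl) (sumBelow-cong n f g (λ i i<n → f≡g i (m≤n⇒m≤1+n i<n)))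

sumBelow-mono : ∀ n (f g : ℕ → ℕ) → (∀ i → i < n → f i ≤ g i) → sumBelow n f ≤ sumBelow n g
sumBelow-mono zero f g f≤g = z≤n
sumBelow-mono (suc n) f g f≤g =
  +-mono-≤ (f≤g n ≤-refl) (sumBelow-mono n f g (λ i i<n → f≤g i (m≤n⇒m≤1+n i<n)))

sumBelow-+ : ∀ n (f g : ℕ → ℕ) → sumBelow n (λ i → f i + g i) ≡ sumBelow n f + sumBelow n g
sumBelow-+ zero f g = refl
sumBelow-+ (suc n) f g = trans (cong (f n + g n +_) (sumBelow-+ n f g)) (+-CS.interchange (f n) (g n) _ _)

sumBelow-* : ∀ n c (f : ℕ → ℕ) → sumBelow n (λ i → c * f i) ≡ c * sumBelow n f
sumBelow-* zero c f = sym (*-zeroʳ c)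
sumBelow-* (suc n) c f = trans (cong (c * f n +_) (sumBelow-* n c f)) (sym (*-distribˡ-+ c (f n) _))

sumBelow-const : ∀ n c → sumBelow n (λ _ → c) ≡ n * c
sumBelow-const zero c = refl
sumBelow-const (suc n) c = cong (c +_) (sumBelow-const n c)

sumBelow-+-range : ∀ a b (f : ℕ → ℕ) → sumBelow (a + b) f ≡ sumBelow b (λ i → f (a + i)) + sumBelow a f
sumBelow-+-range a zero f = cong (λ k → sumBelow k f) (+-identityʳ a)
sumBelow-+-range a (suc b) f = begin
    sumBelow (a + suc b) f
  ≡⟨ cong (λ k → sumBelow k f) (+-suc a b) ⟩
    f (a + b) + sumBelow (a + b) f
  ≡⟨ cong (f (a + b) +_) (sumBelow-+-range a b f) ⟩
    f (a + b) + (sumBelow b (λ i → f (a + i)) + sumBelow a f)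
  ≡⟨ sym (+-assoc (f (a + b)) _ _) ⟩
    sumBelow (suc b) (λ i → f (a + i)) + sumBelow a f
  ∎
  where open ≡-Reasoning

sumBelow-reverse : ∀ n (f : ℕ → ℕ) → sumBelow n f ≡ sumBelow n (λ i → f (n ∸ suc i))
sumBelow-reverse zero f = refl
sumBelow-reverse (suc n) f = begin
    f n + sumBelow n f
  ≡⟨ cong (f n +_) (sumBelow-reverse n f) ⟩
    f n + sumBelow n (λ i → f (n ∸ suc i))
  ≡⟨ +-comm (f n) _ ⟩
    sumBelow n (λ i → f (n ∸ suc i)) + f n
  ≡⟨ cong (sumBelow n (λ i → f (n ∸ suc i)) +_) (sym (+-identityʳ (f n))) ⟩
    sumBelow n (λ i → f (n ∸ suc i)) + sumBelow 1 (λ i → f (n ∸ i))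
  ≡⟨ sym (sumBelow-+-range 1 n (λ i → f (n ∸ i))) ⟩
    sumBelow (suc n) (λ i → f (n ∸ i))
  ∎
  where open ≡-Reasoning

<⇒<ᵇ≡true : ∀ {m n} → m < n → (m <ᵇ n) ≡ true
<⇒<ᵇ≡true {m} {n} m<n with m <ᵇ n | <⇒<ᵇ m<n
... | true | _ = refl

<ᵇ≡true⇒< : ∀ {m n} → (m <ᵇ n) ≡ true → m < n
<ᵇ≡true⇒< {m} {n} eq = <ᵇ⇒< m n (subst T (sym eq) tt)

<ᵇ≡false⇒≥ : ∀ {m n} → (m <ᵇ n) ≡ false → n ≤ m
<ᵇ≡false⇒≥ eq = ≮⇒≥ (λ m<n → subst T eq (<⇒<ᵇ m<n))

≥⇒<ᵇ≡false : ∀ {m n} → n ≤ m → (m <ᵇ n) ≡ false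
≥⇒<ᵇ≡false {m} {n} n≤m with m <ᵇ n in eq
... | false = refl
... | true = ⊥-elim (≤⇒≯ n≤m (<ᵇ≡true⇒< eq))

not<ᵇ⇒≥ : ∀ {x s} → not (x <ᵇ s) ≡ true → s ≤ x
not<ᵇ⇒≥ {x} {s} eq with x <ᵇ s in x≮s
... | false = <ᵇ≡false⇒≥ x≮s

+-<ᵇ-cancelˡ : ∀ s a b → ((s + a) <ᵇ (s + b)) ≡ (a <ᵇ b)
+-<ᵇ-cancelˡ zero a b = refl
+-<ᵇ-cancelˡ (suc s) a b = +-<ᵇ-cancelˡ s a b

^-distribʳ-* : ∀ a b n → (a * b) ^ n ≡ a ^ n * b ^ n
^-distribʳ-* a b zero = refl
^-distribʳ-* a b (suc n) = trans (cong (a * b *_) (^-distribʳ-* a b n)) (*-CS.interchange a b (a ^ n) (b ^ n))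

^-+-blocks : ∀ x r k L → x ^ (r + k * L) ≡ x ^ r * (x ^ L) ^ k
^-+-blocks x r k L = trans (^-distribˡ-+-* x r (k * L))
  (cong (x ^ r *_) (trans (cong (x ^_) (*-comm k L)) (sym (^-*-assoc x L k))))

^-cancelˡ-≤ : ∀ e .{{_ : NonZero e}} a b → a ^ e ≤ b ^ e → a ≤ b
^-cancelˡ-≤ e a b aᵉ≤bᵉ with a ≤? b
... | yes a≤b = a≤b
... | no a≰b = ⊥-elim (<⇒≱ (^-monoˡ-< e (≰⇒> a≰b)) aᵉ≤bᵉ)

^-self-nonZero : ∀ k → NonZero (k ^ k)
^-self-nonZero zero = _
^-self-nonZero (suc k) = m^n≢0 (suc k) (suc k)

-- Sums over arrival orders

punchIn : ℕ → ℕ → ℕ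
punchIn r v = if v <ᵇ r then v else suc v

punchIn-< : ∀ {r v} → v < r → punchIn r v ≡ v
punchIn-< v<r rewrite <⇒<ᵇ≡true v<r = refl

punchIn-≥ : ∀ {r v} → r ≤ v → punchIn r v ≡ suc v
punchIn-≥ r≤v rewrite ≥⇒<ᵇ≡false r≤v = refl

punchIn-+ : ∀ s i v → punchIn (s + i) (s + v) ≡ s + punchIn i v
punchIn-+ s i v rewrite +-<ᵇ-cancelˡ s v i with v <ᵇ i
... | true = refl
... | false = sym (+-suc s v)

Arrangement : ℕ → List ℕ → Set
Arrangement n σ = length σ ≡ n × All (_< n) σ

insertions-bounded : ∀ {b} x τ → x < b → All (_< b) τ →
  All (λ ι → length ι ≡ suc (length τ) × All (_< b) ι) (insertions x τ)
insertions-bounded x [] x<b [] = (refl , x<b ∷ []) ∷ []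
insertions-bounded x (y ∷ ys) x<b (y<b ∷ ys<b) =
  (refl , x<b ∷ y<b ∷ ys<b) ∷
  map⁺ (All.map (λ (len , ι<b) → cong suc len , y<b ∷ ι<b) (insertions-bounded x ys x<b ys<b))

length-insertions : ∀ x τ → length (insertions x τ) ≡ suc (length τ)
length-insertions x [] = refl
length-insertions x (y ∷ ys) = cong suc (trans (length-map (y ∷_) (insertions x ys)) (length-insertions x ys))

perms-arrangements : ∀ n → All (Arrangement n) (perms n)
perms-arrangements zero = (refl , []) ∷ []
perms-arrangements (suc n) = concat⁺ (map⁺ (All.map insertions-arrangements (perms-arrangements n)))
  where
  insertions-arrangements : ∀ {τ} → Arrangement n τ → All (Arrangement (suc n)) (insertions n τ)
  insertions-arrangements (len , τ<n) =
    All.map (λ (len′ , ι<n) → trans len′ (cong suc len) , ι<n)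
            (insertions-bounded n _ ≤-refl (All.map m≤n⇒m≤1+n τ<n))

insertions-punchIn : ∀ {r n} → r ≤ n → ∀ σ →
  insertions (suc n) (map (punchIn r) σ) ≡ map (map (punchIn r)) (insertions n σ)
insertions-punchIn r≤n [] rewrite punchIn-≥ r≤n = refl
insertions-punchIn {r} {n} r≤n (y ∷ ys) rewrite punchIn-≥ r≤n | insertions-punchIn r≤n ys =
  cong ((_ ∷ punchIn r y ∷ map (punchIn r) ys) ∷_)
    (trans (sym (map-∘ (insertions n ys))) (map-∘ (insertions n ys)))

sumOf-insertions-punchIn : ∀ {r n} → r ≤ n → ∀ (f : List ℕ → ℕ) σ →
  sumOf f (insertions (suc n) (map (punchIn r) σ)) ≡ sumOf (f ∘ map (punchIn r)) (insertions n σ)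
sumOf-insertions-punchIn {r} {n} r≤n f σ =
  trans (cong (sumOf f) (insertions-punchIn r≤n σ)) (sumOf-map f (map (punchIn r)) (insertions n σ))

sumPerms : ℕ → (List ℕ → ℕ) → ℕ
sumPerms n f = sumOf f (perms n)

sumPerms-cong : ∀ n (f g : List ℕ → ℕ) → (∀ σ → Arrangement n σ → f σ ≡ g σ) → sumPerms n f ≡ sumPerms n g
sumPerms-cong n f g = sumOf-cong f g (perms-arrangements n)

sumPerms-mono : ∀ n (f g : List ℕ → ℕ) → (∀ σ → Arrangement n σ → f σ ≤ g σ) → sumPerms n f ≤ sumPerms n g
sumPerms-mono n f g = sumOf-mono f g (perms-arrangements n)

sumPerms-ext : ∀ n {f g : List ℕ → ℕ} → (∀ σ → f σ ≡ g σ) → sumPerms n f ≡ sumPerms n g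
sumPerms-ext n {f} {g} f≡g = sumPerms-cong n f g (λ σ _ → f≡g σ)

sumPerms-byFirst : ∀ n (f : List ℕ → ℕ) →
  sumPerms (suc n) f ≡ sumBelow (suc n) (λ r → sumPerms n (λ σ → f (r ∷ map (punchIn r) σ)))
sumPerms-byFirst zero f = sym (+-identityʳ _)
sumPerms-byFirst (suc n) f = begin
    sumPerms (suc (suc n)) f
  ≡⟨ sumOf-concatMap f (insertions (suc n)) (perms (suc n)) ⟩
    sumPerms (suc n) overInsertions
  ≡⟨ sumPerms-byFirst n overInsertions ⟩
    sumBelow (suc n) (λ r → sumPerms n (λ σ → overInsertions (r ∷ map (punchIn r) σ)))
  ≡⟨ sumBelow-cong (suc n) _ _ split ⟩
    sumBelow (suc n) (λ r → maxFirst r + maxLater r)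
  ≡⟨ sumBelow-+ (suc n) maxFirst maxLater ⟩
    sumBelow (suc n) maxFirst + sumBelow (suc n) maxLater
  ≡⟨ cong (_+ sumBelow (suc n) maxLater) (sym (sumPerms-byFirst n (λ τ → f (suc n ∷ τ)))) ⟩
    sumPerms (suc n) (λ τ → f (suc n ∷ τ)) + sumBelow (suc n) maxLater
  ≡⟨ cong (_+ sumBelow (suc n) maxLater) (sumPerms-cong (suc n) _ _ (λ σ (_ , σ<) →
       cong (λ τ → f (suc n ∷ τ)) (sym (map-id-local (All.map punchIn-< σ<))))) ⟩
    maxLater (suc n) + sumBelow (suc n) maxLater
  ∎
  where
  open ≡-Reasoning
  overInsertions : List ℕ → ℕ
  overInsertions τ = sumOf f (insertions (suc n) τ)
  maxFirst maxLater : ℕ → ℕ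
  maxFirst r = sumPerms n (λ σ → f (suc n ∷ r ∷ map (punchIn r) σ))
  maxLater r = sumPerms (suc n) (λ σ → f (r ∷ map (punchIn r) σ))
  split : ∀ r → r < suc n → sumPerms n (λ σ → overInsertions (r ∷ map (punchIn r) σ)) ≡ maxFirst r + maxLater r
  split r (s≤s r≤n) = begin
      sumPerms n (λ σ → overInsertions (r ∷ map (punchIn r) σ))
    ≡⟨ sumPerms-ext n (λ σ → cong (f (suc n ∷ r ∷ map (punchIn r) σ) +_)
         (trans (sumOf-map f (r ∷_) (insertions (suc n) (map (punchIn r) σ)))
                (sumOf-insertions-punchIn r≤n (λ ι → f (r ∷ ι)) σ))) ⟩
      sumPerms n (λ σ → f (suc n ∷ r ∷ map (punchIn r) σ) + sumOf (λ ι → f (r ∷ map (punchIn r) ι)) (insertions n σ))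
    ≡⟨ sumOf-+ _ _ (perms n) ⟩
      maxFirst r + sumPerms n (λ σ → sumOf (λ ι → f (r ∷ map (punchIn r) ι)) (insertions n σ))
    ≡⟨ cong (maxFirst r +_) (sym (sumOf-concatMap (λ ι → f (r ∷ map (punchIn r) ι)) (insertions n) (perms n))) ⟩
      maxFirst r + maxLater r
    ∎

sumPerms-const : ∀ n c → sumPerms n (λ _ → c) ≡ n ! * c
sumPerms-const zero c = refl
sumPerms-const (suc n) c = begin
    sumPerms (suc n) (λ _ → c)
  ≡⟨ sumPerms-byFirst n (λ _ → c) ⟩
    sumBelow (suc n) (λ _ → sumPerms n (λ _ → c))
  ≡⟨ sumBelow-const (suc n) _ ⟩
    suc n * sumPerms n (λ _ → c)
  ≡⟨ cong (suc n *_) (sumPerms-const n c) ⟩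
    suc n * (n ! * c)
  ≡⟨ sym (*-assoc (suc n) (n !) c) ⟩
    suc n ! * c
  ∎
  where open ≡-Reasoning

below above : ℕ → List ℕ → List ℕ
below r = filterᵇ (_<ᵇ r)
above r = filterᵇ (λ v → not (v <ᵇ r))

filterᵇ-map : (p q : ℕ → Bool) (f g : ℕ → ℕ) → (∀ x → p (f x) ≡ q x) → (∀ x → q x ≡ true → f x ≡ g x) →
  ∀ xs → filterᵇ p (map f xs) ≡ map g (filterᵇ q xs)
filterᵇ-map p q f g p∘f≡q f≡g [] = refl
filterᵇ-map p q f g p∘f≡q f≡g (x ∷ xs) rewrite p∘f≡q x with q x in qx
... | true = cong₂ _∷_ (f≡g x qx) (filterᵇ-map p q f g p∘f≡q f≡g xs)
... | false = filterᵇ-map p q f g p∘f≡q f≡g xs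

filterᵇ-∷-cong : (p : ℕ → Bool) (y : ℕ) {xs ys : List ℕ} →
  filterᵇ p xs ≡ filterᵇ p ys → filterᵇ p (y ∷ xs) ≡ filterᵇ p (y ∷ ys)
filterᵇ-∷-cong p y eq with p y
... | true = cong (y ∷_) eq
... | false = eq

above-zero : ∀ σ → above 0 σ ≡ σ
above-zero [] = refl
above-zero (x ∷ σ) = cong (x ∷_) (above-zero σ)

below-all : ∀ r {σ} → All (_< r) σ → below r σ ≡ σ
below-all r σ<r = filter-all (T? ∘ (_<ᵇ r)) (All.map <⇒<ᵇ σ<r)

above-none : ∀ r {σ} → All (_< r) σ → above r σ ≡ []
above-none r σ<r = filter-none (T? ∘ (λ v → not (v <ᵇ r)))
  (All.map (λ v<r → subst (λ b → ¬ T (not b)) (sym (<⇒<ᵇ≡true v<r)) id) σ<r)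

punchIn-<ᵇ-suc : ∀ {r s} → r ≤ s → ∀ x → (punchIn r x <ᵇ suc s) ≡ (x <ᵇ s)
punchIn-<ᵇ-suc {r} r≤s x with x <? r
... | yes x<r rewrite punchIn-< x<r =
  trans (<⇒<ᵇ≡true (m<n⇒m<1+n x<s)) (sym (<⇒<ᵇ≡true x<s))
  where x<s = <-≤-trans x<r r≤s
... | no x≮r rewrite punchIn-≥ (≮⇒≥ x≮r) = refl

punchIn-<ᵇ : ∀ {r s} → s ≤ r → ∀ x → (punchIn r x <ᵇ s) ≡ (x <ᵇ s)
punchIn-<ᵇ {r} s≤r x with x <? r
... | yes x<r rewrite punchIn-< x<r = refl
... | no x≮r rewrite punchIn-≥ (≮⇒≥ x≮r) =
  trans (≥⇒<ᵇ≡false (m≤n⇒m≤1+n s≤x)) (sym (≥⇒<ᵇ≡false s≤x))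
  where s≤x = ≤-trans s≤r (≮⇒≥ x≮r)

below-punchIn : ∀ {r s} → s ≤ r → ∀ σ → below s (map (punchIn r) σ) ≡ below s σ
below-punchIn s≤r σ =
  trans (filterᵇ-map _ _ _ id (punchIn-<ᵇ s≤r) (λ x x<s → punchIn-< (<-≤-trans (<ᵇ≡true⇒< x<s) s≤r)) σ)
        (map-id _)

above-punchIn-suc : ∀ {r s} → r ≤ s → ∀ σ → above (suc s) (map (punchIn r) σ) ≡ map suc (above s σ)
above-punchIn-suc r≤s = filterᵇ-map _ _ _ suc (λ x → cong not (punchIn-<ᵇ-suc r≤s x))
  (λ x x≥s → punchIn-≥ (≤-trans r≤s (not<ᵇ⇒≥ x≥s)))

above-punchIn : ∀ {r s} → s ≤ r → ∀ σ → above s (map (punchIn r) σ) ≡ map (punchIn r) (above s σ)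
above-punchIn s≤r = filterᵇ-map _ _ _ _ (λ x → cong not (punchIn-<ᵇ s≤r x)) (λ _ _ → refl)

above-punchIn-self : ∀ r σ → above r (map (punchIn r) σ) ≡ map suc (above r σ)
above-punchIn-self r = filterᵇ-map _ _ _ suc (λ x → cong not (punchIn-<ᵇ {r} ≤-refl x))
  (λ x x≥r → punchIn-≥ (not<ᵇ⇒≥ {x} {r} x≥r))

map-punchIn-+ : ∀ s i β → map (punchIn (s + i)) (map (s +_) β) ≡ map (s +_) (map (punchIn i) β)
map-punchIn-+ s i β = trans (sym (map-∘ β)) (trans (map-cong (punchIn-+ s i) β) (map-∘ β))

below-∷-≥ : ∀ {r x} → r ≤ x → ∀ τ → below r (x ∷ τ) ≡ below r τ
below-∷-≥ {r} r≤x τ = filter-reject (T? ∘ (_<ᵇ r)) (λ x<r → subst T (≥⇒<ᵇ≡false r≤x) x<r)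

below-insertions : ∀ {r x} → r ≤ x → ∀ τ → All (λ ι → below r ι ≡ below r τ) (insertions x τ)
below-insertions r≤x [] = below-∷-≥ r≤x [] ∷ []
below-insertions {r} r≤x (y ∷ ys) =
  below-∷-≥ r≤x (y ∷ ys) ∷ map⁺ (All.map (filterᵇ-∷-cong (_<ᵇ r) y) (below-insertions r≤x ys))

P′-suc : ∀ n k → suc n P′ suc k ≡ suc n * (n P′ k)
P′-suc n k = nP′k≡n[n∸1P′k∸1] (suc n) (suc k)

-- Inserting the largest value leaves below r unchanged, so each step of the recursion defining perms
-- just multiplies the sum by the number of insertion points.
sumPerms-below : ∀ r k (g : List ℕ → ℕ) → sumPerms (r + k) (g ∘ below r) ≡ ((r + k) P′ k) * sumPerms r g
sumPerms-below r zero g rewrite +-identityʳ r =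
  trans (sumPerms-cong r _ _ (λ σ (_ , σ<r) → cong g (below-all r σ<r))) (sym (*-identityˡ _))
sumPerms-below r (suc k) g = begin
    sumPerms (r + suc k) (g ∘ below r)
  ≡⟨ cong (λ n → sumPerms n (g ∘ below r)) (+-suc r k) ⟩
    sumOf (g ∘ below r) (concatMap (insertions n) (perms n))
  ≡⟨ sumOf-concatMap (g ∘ below r) (insertions n) (perms n) ⟩
    sumPerms n (λ τ → sumOf (g ∘ below r) (insertions n τ))
  ≡⟨ sumPerms-cong n _ _ (λ τ (len , _) → sumOver-insertions τ len) ⟩
    sumPerms n (λ τ → suc n * g (below r τ))
  ≡⟨ sumOf-* (suc n) _ (perms n) ⟩
    suc n * sumPerms n (g ∘ below r)
  ≡⟨ cong (suc n *_) (sumPerms-below r k g) ⟩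
    suc n * ((n P′ k) * sumPerms r g)
  ≡⟨ sym (*-assoc (suc n) (n P′ k) (sumPerms r g)) ⟩
    suc n * (n P′ k) * sumPerms r g
  ≡⟨ cong (_* sumPerms r g) (sym (P′-suc n k)) ⟩
    (suc n P′ suc k) * sumPerms r g
  ≡⟨ cong (λ n → (n P′ suc k) * sumPerms r g) (sym (+-suc r k)) ⟩
    ((r + suc k) P′ suc k) * sumPerms r g
  ∎
  where
  open ≡-Reasoning
  n = r + k
  sumOver-insertions : ∀ τ → length τ ≡ n → sumOf (g ∘ below r) (insertions n τ) ≡ suc n * g (below r τ)
  sumOver-insertions τ len = begin
      sumOf (g ∘ below r) (insertions n τ)
    ≡⟨ sumOf-cong _ (λ _ → g (below r τ)) (below-insertions (m≤m+n r k) τ) (λ _ → cong g) ⟩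
      sumOf (λ _ → g (below r τ)) (insertions n τ)
    ≡⟨ sumOf-const (g (below r τ)) (insertions n τ) ⟩
      length (insertions n τ) * g (below r τ)
    ≡⟨ cong (_* g (below r τ)) (trans (length-insertions n τ) (cong suc len)) ⟩
      suc n * g (below r τ)
    ∎

sumPerms-above : ∀ s k (g : List ℕ → ℕ) →
  sumPerms (s + k) (g ∘ above s) ≡ ((s + k) P′ s) * sumPerms k (g ∘ map (s +_))
sumPerms-above zero k g =
  trans (sumPerms-ext k (λ σ → cong g (trans (above-zero σ) (sym (map-id σ))))) (sym (*-identityˡ _))
sumPerms-above (suc s) zero g rewrite +-identityʳ s = begin
    sumPerms (suc s) (g ∘ above (suc s))
  ≡⟨ sumPerms-cong (suc s) _ _ (λ σ (_ , σ<) → cong g (above-none (suc s) σ<)) ⟩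
    sumPerms (suc s) (λ _ → g [])
  ≡⟨ sumPerms-const (suc s) (g []) ⟩
    suc s ! * g []
  ≡⟨ cong₂ _*_ (sym (nP′n≡n! (suc s))) (sym (+-identityʳ (g []))) ⟩
    (suc s P′ suc s) * (g [] + 0)
  ∎
  where open ≡-Reasoning
sumPerms-above (suc s) (suc k) g = begin
    sumPerms (suc n) (g ∘ above (suc s))
  ≡⟨ sumPerms-byFirst n _ ⟩
    sumBelow (suc s + suc k) byFirst
  ≡⟨ sumBelow-+-range (suc s) (suc k) byFirst ⟩
    sumBelow (suc k) (λ i → byFirst (suc s + i)) + sumBelow (suc s) byFirst
  ≡⟨ cong₂ _+_ (sumBelow-cong (suc k) _ _ (λ i _ → firstKept i)) (sumBelow-cong (suc s) _ _ firstDropped) ⟩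
    sumBelow (suc k) (λ i → B * shifted i) + sumBelow (suc s) (λ _ → F * Y)
  ≡⟨ cong₂ _+_ (sumBelow-* (suc k) B shifted) (sumBelow-const (suc s) (F * Y)) ⟩
    B * sumBelow (suc k) shifted + suc s * (F * Y)
  ≡⟨ cong (λ z → B * z + suc s * (F * Y)) (sym (sumPerms-byFirst k (g ∘ map (suc s +_)))) ⟩
    B * Y + suc s * (F * Y)
  ≡⟨ cong (λ z → z * Y + suc s * (F * Y)) B≡[1+k]F ⟩
    suc k * F * Y + suc s * (F * Y)
  ≡⟨ regroup s k F Y ⟩
    suc n * F * Y
  ≡⟨ cong (_* Y) (sym (P′-suc n s)) ⟩
    (suc n P′ suc s) * Y
  ∎
  where
  open ≡-Reasoning
  n = s + suc k
  byFirst : ℕ → ℕ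
  byFirst r = sumPerms n (λ σ → g (above (suc s) (r ∷ map (punchIn r) σ)))
  shifted : ℕ → ℕ
  shifted i = sumPerms k (λ β → g (map (suc s +_) (i ∷ map (punchIn i) β)))
  Y = sumPerms (suc k) (g ∘ map (suc s +_))
  F = n P′ s
  B = (suc s + k) P′ suc s
  B≡[1+k]F : B ≡ suc k * F
  B≡[1+k]F = trans (cong (_P′ suc s) (sym (+-suc s k)))
                   (cong (_* F) (m+n∸m≡n s (suc k)))
  regroup : ∀ s k F Y → (1 + k) * F * Y + (1 + s) * (F * Y) ≡ (1 + (s + (1 + k))) * F * Y
  regroup = solve-∀
  firstDropped : ∀ r → r < suc s → byFirst r ≡ F * Y
  firstDropped r (s≤s r≤s) rewrite <⇒<ᵇ≡true {r} {suc s} (s≤s r≤s) = begin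
      sumPerms n (λ σ → g (above (suc s) (map (punchIn r) σ)))
    ≡⟨ sumPerms-ext n (λ σ → cong g (above-punchIn-suc r≤s σ)) ⟩
      sumPerms n (λ σ → g (map suc (above s σ)))
    ≡⟨ sumPerms-above s (suc k) (g ∘ map suc) ⟩
      F * sumPerms (suc k) (λ β → g (map suc (map (s +_) β)))
    ≡⟨ cong (F *_) (sumPerms-ext (suc k) (λ β → cong g (sym (map-∘ β)))) ⟩
      F * Y
    ∎
  firstKept : ∀ i → byFirst (suc s + i) ≡ B * shifted i
  firstKept i rewrite ≥⇒<ᵇ≡false {suc s + i} {suc s} (m≤m+n (suc s) i) = begin
      sumPerms n (λ σ → g (r ∷ above (suc s) (map (punchIn r) σ)))
    ≡⟨ sumPerms-ext n (λ σ → cong (λ τ → g (r ∷ τ)) (above-punchIn (m≤m+n (suc s) i) σ)) ⟩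
      sumPerms n (λ σ → g (r ∷ map (punchIn r) (above (suc s) σ)))
    ≡⟨ cong (λ m → sumPerms m (λ σ → g (r ∷ map (punchIn r) (above (suc s) σ)))) (+-suc s k) ⟩
      sumPerms (suc s + k) (λ σ → g (r ∷ map (punchIn r) (above (suc s) σ)))
    ≡⟨ sumPerms-above (suc s) k (λ β → g (r ∷ map (punchIn r) β)) ⟩
      B * sumPerms k (λ β → g (r ∷ map (punchIn r) (map (suc s +_) β)))
    ≡⟨ cong (B *_) (sumPerms-ext k (λ β → cong (λ τ → g (r ∷ τ)) (map-punchIn-+ (suc s) i β))) ⟩
      B * shifted i
    ∎
    where r = suc s + i

sumPerms-below′ : ∀ {r n} → r ≤ n → ∀ (g : List ℕ → ℕ) →
  sumPerms n (g ∘ below r) ≡ (n P′ (n ∸ r)) * sumPerms r g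
sumPerms-below′ {r} {n} r≤n g =
  subst (λ m → sumPerms m (g ∘ below r) ≡ (m P′ (n ∸ r)) * sumPerms r g) (m+[n∸m]≡n r≤n)
        (sumPerms-below r (n ∸ r) g)

sumPerms-above′ : ∀ {r n} → r ≤ n → ∀ (g : List ℕ → ℕ) →
  sumPerms n (g ∘ above r) ≡ (n P′ r) * sumPerms (n ∸ r) (g ∘ map (r +_))
sumPerms-above′ {r} {n} r≤n g =
  subst (λ m → sumPerms m (g ∘ above r) ≡ (m P′ r) * sumPerms (n ∸ r) (g ∘ map (r +_))) (m+[n∸m]≡n r≤n)
        (sumPerms-above r (n ∸ r) g)

-- The depth profile of a random binary search tree

insertKey : ℕ → BST → BST
insertKey x leaf = node leaf x leaf
insertKey x (node l y r) = if x <ᵇ y then node (insertKey x l) y r else node l y (insertKey x r)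

insertAll : BST → List ℕ → BST
insertAll t [] = t
insertAll t (x ∷ xs) = insertAll (insertKey x t) xs

bst : List ℕ → BST
bst = insertAll leaf

nodesAt : ℕ → BST → ℕ
nodesAt d leaf = 0
nodesAt zero (node _ _ _) = 1
nodesAt (suc d) (node l _ r) = nodesAt d l + nodesAt d r

mapKeys : (ℕ → ℕ) → BST → BST
mapKeys f leaf = leaf
mapKeys f (node l x r) = node (mapKeys f l) (f x) (mapKeys f r)

insertAll-node : ∀ l y r xs → insertAll (node l y r) xs ≡ node (insertAll l (below y xs)) y (insertAll r (above y xs))
insertAll-node l y r [] = refl
insertAll-node l y r (x ∷ xs) with x <ᵇ y
... | true = insertAll-node (insertKey x l) y r xs
... | false = insertAll-node l y (insertKey x r) xs

module _ (f : ℕ → ℕ) (f-<ᵇ : ∀ a b → (f a <ᵇ f b) ≡ (a <ᵇ b)) where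

  insertKey-mapKeys : ∀ x t → insertKey (f x) (mapKeys f t) ≡ mapKeys f (insertKey x t)
  insertKey-mapKeys x leaf = refl
  insertKey-mapKeys x (node l y r) rewrite f-<ᵇ x y with x <ᵇ y
  ... | true = cong (λ l′ → node l′ (f y) (mapKeys f r)) (insertKey-mapKeys x l)
  ... | false = cong (node (mapKeys f l) (f y)) (insertKey-mapKeys x r)

  insertAll-mapKeys : ∀ t xs → insertAll (mapKeys f t) (map f xs) ≡ mapKeys f (insertAll t xs)
  insertAll-mapKeys t [] = refl
  insertAll-mapKeys t (x ∷ xs) rewrite insertKey-mapKeys x t = insertAll-mapKeys (insertKey x t) xs

nodesAt-mapKeys : ∀ f d t → nodesAt d (mapKeys f t) ≡ nodesAt d t
nodesAt-mapKeys f d leaf = refl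
nodesAt-mapKeys f zero (node l x r) = refl
nodesAt-mapKeys f (suc d) (node l x r) = cong₂ _+_ (nodesAt-mapKeys f d l) (nodesAt-mapKeys f d r)

nodesAt-bst-shift : ∀ s d xs → nodesAt d (bst (map (s +_) xs)) ≡ nodesAt d (bst xs)
nodesAt-bst-shift s d xs =
  trans (cong (nodesAt d) (insertAll-mapKeys (s +_) (+-<ᵇ-cancelˡ s) leaf xs)) (nodesAt-mapKeys (s +_) d (bst xs))

nodesAt-bst-root : ∀ r d σ →
  nodesAt (suc d) (bst (r ∷ map (punchIn r) σ)) ≡ nodesAt d (bst (below r σ)) + nodesAt d (bst (above r σ))
nodesAt-bst-root r d σ = begin
    nodesAt (suc d) (bst (r ∷ map (punchIn r) σ))
  ≡⟨ cong (nodesAt (suc d)) (insertAll-node leaf r leaf (map (punchIn r) σ)) ⟩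
    nodesAt d (bst (below r (map (punchIn r) σ))) + nodesAt d (bst (above r (map (punchIn r) σ)))
  ≡⟨ cong₂ _+_ (cong (nodesAt d ∘ bst) (below-punchIn {r} ≤-refl σ))
               (cong (nodesAt d ∘ bst) (above-punchIn-self r σ)) ⟩
    nodesAt d (bst (below r σ)) + nodesAt d (bst (map suc (above r σ)))
  ≡⟨ cong (nodesAt d (bst (below r σ)) +_) (nodesAt-bst-shift 1 d (above r σ)) ⟩
    nodesAt d (bst (below r σ)) + nodesAt d (bst (above r σ))
  ∎
  where open ≡-Reasoning

profile : ℕ → ℕ → ℕ
profile n d = sumPerms n (λ σ → nodesAt d (bst σ))

profile-suc : ∀ n d → profile (suc n) (suc d) ≡
  sumBelow (suc n) (λ r → (n P′ (n ∸ r)) * profile r d + (n P′ r) * profile (n ∸ r) d)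
profile-suc n d = trans (sumPerms-byFirst n _) (sumBelow-cong (suc n) _ _ byRoot)
  where
  byRoot : ∀ r → r < suc n → sumPerms n (λ σ → nodesAt (suc d) (bst (r ∷ map (punchIn r) σ))) ≡
                              (n P′ (n ∸ r)) * profile r d + (n P′ r) * profile (n ∸ r) d
  byRoot r (s≤s r≤n) = begin
      sumPerms n (λ σ → nodesAt (suc d) (bst (r ∷ map (punchIn r) σ)))
    ≡⟨ sumPerms-ext n (nodesAt-bst-root r d) ⟩
      sumPerms n (λ σ → nodesAt d (bst (below r σ)) + nodesAt d (bst (above r σ)))
    ≡⟨ sumOf-+ _ _ (perms n) ⟩
      sumPerms n (nodesAt d ∘ bst ∘ below r) + sumPerms n (nodesAt d ∘ bst ∘ above r)
    ≡⟨ cong₂ _+_ (sumPerms-below′ r≤n (nodesAt d ∘ bst)) (sumPerms-above′ r≤n (nodesAt d ∘ bst)) ⟩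
      (n P′ (n ∸ r)) * profile r d + (n P′ r) * sumPerms (n ∸ r) (nodesAt d ∘ bst ∘ map (r +_))
    ≡⟨ cong (λ z → (n P′ (n ∸ r)) * profile r d + (n P′ r) * z) (sumPerms-ext (n ∸ r) (nodesAt-bst-shift r d)) ⟩
      (n P′ (n ∸ r)) * profile r d + (n P′ r) * profile (n ∸ r) d
    ∎
    where open ≡-Reasoning

nodesAt-zero-insertAll : ∀ l y r xs → nodesAt 0 (insertAll (node l y r) xs) ≡ 1
nodesAt-zero-insertAll l y r xs rewrite insertAll-node l y r xs = refl

profile-zero : ∀ n → profile (suc n) 0 ≡ suc n !
profile-zero n = trans (sumPerms-cong (suc n) _ (λ _ → 1) rootOnly) (trans (sumPerms-const (suc n) 1) (*-identityʳ _))
  where rootOnly : ∀ σ → Arrangement (suc n) σ → nodesAt 0 (bst σ) ≡ 1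
        rootOnly (x ∷ σ) _ = nodesAt-zero-insertAll leaf x leaf σ

module ProfileBound (p q : ℕ) where

  -- For n ≥ 1, K n / (n! q^n) = ∏_{2 ≤ j ≤ n} (1 + p / (q j)); profile-bound shows that it dominates
  -- z^d · E[#nodes at depth d] for z = (q + p) / 2q and every d.
  K : ℕ → ℕ
  K zero = 0
  K (suc zero) = q
  K (suc (suc n)) = (q * suc (suc n) + p) * K (suc n)

  rootSum : ℕ → ℕ
  rootSum n = sumBelow (suc n) (λ r → (n P′ (n ∸ r)) * q ^ (n ∸ r) * K r)

  rootSum-suc : ∀ n → rootSum (suc n) ≡ K (suc n) + suc n * q * rootSum n
  rootSum-suc n = begin
      rootSum (suc n)
    ≡⟨ cong (λ k → (suc n P′ k) * q ^ k * K (suc n) + sumBelow (suc n) (λ r → (suc n P′ (suc n ∸ r)) * q ^ (suc n ∸ r) * K r)) (n∸n≡0 n) ⟩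
      1 * 1 * K (suc n) + sumBelow (suc n) (λ r → (suc n P′ (suc n ∸ r)) * q ^ (suc n ∸ r) * K r)
    ≡⟨ cong₂ _+_ (*-identityˡ (K (suc n))) (sumBelow-cong (suc n) _ _ term) ⟩
      K (suc n) + sumBelow (suc n) (λ r → suc n * q * ((n P′ (n ∸ r)) * q ^ (n ∸ r) * K r))
    ≡⟨ cong (K (suc n) +_) (sumBelow-* (suc n) (suc n * q) _) ⟩
      K (suc n) + suc n * q * rootSum n
    ∎
    where
    open ≡-Reasoning
    term : ∀ r → r < suc n →
      (suc n P′ (suc n ∸ r)) * q ^ (suc n ∸ r) * K r ≡ suc n * q * ((n P′ (n ∸ r)) * q ^ (n ∸ r) * K r)
    term r (s≤s r≤n) rewrite +-∸-assoc 1 r≤n | P′-suc n (n ∸ r) =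
      rearrange (suc n) (n P′ (n ∸ r)) q (q ^ (n ∸ r)) (K r)
      where rearrange : ∀ a b c d e → a * b * (c * d) * e ≡ a * c * (b * d * e)
            rearrange = solve-∀

  rootSum-bound : ∀ n → (q + p) * rootSum n ≤ K (suc n)
  rootSum-bound zero = ≤-trans (≤-reflexive (*-zeroʳ (q + p))) z≤n
  rootSum-bound (suc n) = begin
      (q + p) * rootSum (suc n)
    ≡⟨ cong ((q + p) *_) (rootSum-suc n) ⟩
      (q + p) * (K (suc n) + suc n * q * rootSum n)
    ≡⟨ distrib (q + p) (K (suc n)) (suc n * q) (rootSum n) ⟩
      (q + p) * K (suc n) + suc n * q * ((q + p) * rootSum n)
    ≤⟨ +-monoʳ-≤ ((q + p) * K (suc n)) (*-monoʳ-≤ (suc n * q) (rootSum-bound n)) ⟩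
      (q + p) * K (suc n) + suc n * q * K (suc n)
    ≡⟨ collect q p n (K (suc n)) ⟩
      (q * suc (suc n) + p) * K (suc n)
    ∎
    where
    open ≤-Reasoning
    distrib : ∀ a b c d → a * (b + c * d) ≡ a * b + c * (a * d)
    distrib = solve-∀
    collect : ∀ q p n k → (q + p) * k + (1 + n) * q * k ≡ (q * (2 + n) + p) * k
    collect = solve-∀

  !*q^≤K : ∀ n → suc n ! * q ^ suc n ≤ K (suc n)
  !*q^≤K zero = ≤-reflexive (trans (+-identityʳ (q * 1)) (*-identityʳ q))
  !*q^≤K (suc n) = begin
      suc (suc n) ! * q ^ suc (suc n)
    ≡⟨ rearrange (suc (suc n)) (suc n !) q (q ^ suc n) ⟩
      (q * suc (suc n)) * (suc n ! * q ^ suc n)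
    ≤⟨ *-mono-≤ (m≤m+n (q * suc (suc n)) p) (!*q^≤K n) ⟩
      (q * suc (suc n) + p) * K (suc n)
    ∎
    where
    open ≤-Reasoning
    rearrange : ∀ a b c d → a * b * (c * d) ≡ (c * a) * (b * d)
    rearrange = solve-∀

  rootSum-reverse : ∀ n → sumBelow (suc n) (λ r → (n P′ r) * q ^ r * K (n ∸ r)) ≡ rootSum n
  rootSum-reverse n = trans (sumBelow-reverse (suc n) _)
    (sumBelow-cong (suc n) _ _ (λ r r<1+n →
       cong (λ k → (n P′ (n ∸ r)) * q ^ (n ∸ r) * K k) (m∸[m∸n]≡n (≤-pred r<1+n))))

  rootTerm-bound : ∀ d r e c → profile r d * ((q + p) ^ d * q ^ r) ≤ (2 * q) ^ d * K r →
    (q + p) ^ suc d * q ^ suc (e + r) * (c * profile r d) ≤ (q + p) * q * (2 * q) ^ d * (c * q ^ e * K r)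
  rootTerm-bound d r e c ih = begin
      (q + p) ^ suc d * q ^ suc (e + r) * (c * profile r d)
    ≡⟨ cong (λ x → (q + p) ^ suc d * (q * x) * (c * profile r d)) (^-distribˡ-+-* q e r) ⟩
      (q + p) * (q + p) ^ d * (q * (q ^ e * q ^ r)) * (c * profile r d)
    ≡⟨ regroup (q + p) q ((q + p) ^ d) c (profile r d) (q ^ e) (q ^ r) ⟩
      (q + p) * q * (c * q ^ e) * (profile r d * ((q + p) ^ d * q ^ r))
    ≤⟨ *-monoʳ-≤ ((q + p) * q * (c * q ^ e)) ih ⟩
      (q + p) * q * (c * q ^ e) * ((2 * q) ^ d * K r)
    ≡⟨ regroup′ (q + p) q ((2 * q) ^ d) (c * q ^ e) (K r) ⟩
      (q + p) * q * (2 * q) ^ d * (c * q ^ e * K r)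
    ∎
    where
    open ≤-Reasoning
    regroup : ∀ a q x c N qe qr → a * x * (q * (qe * qr)) * (c * N) ≡ a * q * (c * qe) * (N * (x * qr))
    regroup = solve-∀
    regroup′ : ∀ a q b x k → a * q * x * (b * k) ≡ a * q * b * (x * k)
    regroup′ = solve-∀

  profile-bound : ∀ d n → profile n d * ((q + p) ^ d * q ^ n) ≤ (2 * q) ^ d * K n
  profile-bound d zero = z≤n
  profile-bound zero (suc n) = begin
      profile (suc n) 0 * (1 * q ^ suc n)
    ≡⟨ cong₂ _*_ (profile-zero n) (*-identityˡ _) ⟩
      suc n ! * q ^ suc n
    ≤⟨ !*q^≤K n ⟩
      K (suc n)
    ≡⟨ sym (*-identityˡ _) ⟩
      1 * K (suc n)
    ∎
    where open ≤-Reasoning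
  profile-bound (suc d) (suc n) = begin
      profile (suc n) (suc d) * W
    ≡⟨ cong (_* W) (profile-suc n d) ⟩
      sumBelow (suc n) byRoot * W
    ≡⟨ *-comm _ W ⟩
      W * sumBelow (suc n) byRoot
    ≡⟨ sym (sumBelow-* (suc n) W byRoot) ⟩
      sumBelow (suc n) (λ r → W * byRoot r)
    ≤⟨ sumBelow-mono (suc n) _ _ termBound ⟩
      sumBelow (suc n) (λ r → C * left r + C * right r)
    ≡⟨ sumBelow-+ (suc n) (λ r → C * left r) (λ r → C * right r) ⟩
      sumBelow (suc n) (λ r → C * left r) + sumBelow (suc n) (λ r → C * right r)
    ≡⟨ cong₂ _+_ (sumBelow-* (suc n) C left) (sumBelow-* (suc n) C right) ⟩
      C * rootSum n + C * sumBelow (suc n) right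
    ≡⟨ cong (λ z → C * rootSum n + C * z) (rootSum-reverse n) ⟩
      C * rootSum n + C * rootSum n
    ≡⟨ double (q + p) q ((2 * q) ^ d) (rootSum n) ⟩
      (2 * q) ^ d * (2 * q) * ((q + p) * rootSum n)
    ≤⟨ *-monoʳ-≤ ((2 * q) ^ d * (2 * q)) (rootSum-bound n) ⟩
      (2 * q) ^ d * (2 * q) * K (suc n)
    ≡⟨ cong (_* K (suc n)) (*-comm ((2 * q) ^ d) (2 * q)) ⟩
      (2 * q) ^ suc d * K (suc n)
    ∎
    where
    open ≤-Reasoning
    W = (q + p) ^ suc d * q ^ suc n
    C = (q + p) * q * (2 * q) ^ d
    byRoot left right : ℕ → ℕ
    byRoot r = (n P′ (n ∸ r)) * profile r d + (n P′ r) * profile (n ∸ r) d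
    left r = (n P′ (n ∸ r)) * q ^ (n ∸ r) * K r
    right r = (n P′ r) * q ^ r * K (n ∸ r)
    double : ∀ a q b x → a * q * b * x + a * q * b * x ≡ b * (2 * q) * (a * x)
    double = solve-∀
    termBound : ∀ r → r < suc n → W * byRoot r ≤ C * left r + C * right r
    termBound r (s≤s r≤n) = begin
        W * byRoot r
      ≡⟨ *-distribˡ-+ W _ _ ⟩
        W * ((n P′ (n ∸ r)) * profile r d) + W * ((n P′ r) * profile (n ∸ r) d)
      ≡⟨ cong₂ (λ a b → (q + p) ^ suc d * q ^ suc a * ((n P′ (n ∸ r)) * profile r d)
                       + (q + p) ^ suc d * q ^ suc b * ((n P′ r) * profile (n ∸ r) d))
               (sym (m∸n+n≡m r≤n)) (sym (m+[n∸m]≡n r≤n)) ⟩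
        (q + p) ^ suc d * q ^ suc (n ∸ r + r) * ((n P′ (n ∸ r)) * profile r d)
          + (q + p) ^ suc d * q ^ suc (r + (n ∸ r)) * ((n P′ r) * profile (n ∸ r) d)
      ≤⟨ +-mono-≤ (rootTerm-bound d r (n ∸ r) (n P′ (n ∸ r)) (profile-bound d r))
                  (rootTerm-bound d (n ∸ r) r (n P′ r) (profile-bound d (n ∸ r))) ⟩
        C * left r + C * right r
      ∎

-- Weighted AM–GM and the growth of the potential

bernoulli : ∀ N d n → N * N ^ n + suc n * N ^ n * d ≤ (N + d) ^ suc n
bernoulli N d zero = ≤-reflexive (expand N d)
  where expand : ∀ N d → N * 1 + 1 * 1 * d ≡ (N + d) * 1
        expand = solve-∀
bernoulli N d (suc n) = begin
    N * (N * N ^ n) + suc (suc n) * (N * N ^ n) * d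
  ≤⟨ m≤m+n _ (d * (suc n * N ^ n * d)) ⟩
    N * (N * N ^ n) + suc (suc n) * (N * N ^ n) * d + d * (suc n * N ^ n * d)
  ≡⟨ factor N d (N ^ n) n ⟩
    (N + d) * (N * N ^ n + suc n * N ^ n * d)
  ≤⟨ *-monoʳ-≤ (N + d) (bernoulli N d n) ⟩
    (N + d) * (N + d) ^ suc n
  ∎
  where
  open ≤-Reasoning
  factor : ∀ N d P n → N * (N * P) + (2 + n) * (N * P) * d + d * ((1 + n) * P * d) ≡
                       (N + d) * (N * P + (1 + n) * P * d)
  factor = solve-∀

mean-value-bound : ∀ M d n → (M + d) ^ suc n ≤ M * M ^ n + suc n * (M + d) ^ n * d
mean-value-bound M d zero = ≤-reflexive (expand M d)
  where expand : ∀ M d → (M + d) * 1 ≡ M * 1 + 1 * 1 * d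
        expand = solve-∀
mean-value-bound M d (suc n) = begin
    (M + d) * (M + d) ^ suc n
  ≤⟨ *-monoʳ-≤ (M + d) (mean-value-bound M d n) ⟩
    (M + d) * (M * M ^ n + suc n * Q * d)
  ≡⟨ expand M d (M ^ n) Q n ⟩
    M * (M * M ^ n) + d * (M * M ^ n) + suc n * ((M + d) * Q) * d
  ≤⟨ +-monoˡ-≤ _ (+-monoʳ-≤ (M * (M * M ^ n)) (*-monoʳ-≤ d (^-monoˡ-≤ (suc n) (m≤m+n M d)))) ⟩
    M * (M * M ^ n) + d * ((M + d) * Q) + suc n * ((M + d) * Q) * d
  ≡⟨ collect M d (M * M ^ n) ((M + d) * Q) n ⟩
    M * (M * M ^ n) + suc (suc n) * ((M + d) * Q) * d
  ∎
  where
  open ≤-Reasoning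
  Q = (M + d) ^ n
  expand : ∀ M d P Q n → (M + d) * (M * P + (1 + n) * Q * d) ≡
                         M * (M * P) + d * (M * P) + (1 + n) * ((M + d) * Q) * d
  expand = solve-∀
  collect : ∀ M d X Y n → M * X + d * Y + (1 + n) * Y * d ≡ M * X + (2 + n) * Y * d
  collect = solve-∀

amgm-scaled-large : ∀ k S d → (suc k * S) ^ suc k * (S + d) ≤ S * (suc k * S + d) ^ suc k
amgm-scaled-large k S d = begin
    (suc k * S) ^ suc k * (S + d)
  ≡⟨ sym (expand k S d ((suc k * S) ^ k)) ⟩
    S * (suc k * S * (suc k * S) ^ k + suc k * (suc k * S) ^ k * d)
  ≤⟨ *-monoʳ-≤ S (bernoulli (suc k * S) d k) ⟩
    S * (suc k * S + d) ^ suc k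
  ∎
  where
  open ≤-Reasoning
  expand : ∀ k S d P → S * ((1 + k) * S * P + (1 + k) * P * d) ≡ (1 + k) * S * P * (S + d)
  expand = solve-∀

amgm-scaled-small : ∀ k a d → (suc k * (a + d)) ^ suc k * a ≤ (a + d) * (k * (a + d) + a) ^ suc k
amgm-scaled-small k a d = subst (λ u → u ^ suc k * a ≤ (a + d) * v ^ suc k) v+d≡u scaled
  where
  v = k * (a + d) + a
  X = (v + d) ^ suc k
  v+d≡u : v + d ≡ suc k * (a + d)
  v+d≡u = collect k a d
    where collect : ∀ k a d → k * (a + d) + a + d ≡ (1 + k) * (a + d)
          collect = solve-∀
  bound : (a + d) * X ≤ (a + d) * v ^ suc k + d * X
  bound = begin
      (a + d) * X
    ≤⟨ *-monoʳ-≤ (a + d) (mean-value-bound v d k) ⟩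
      (a + d) * (v * v ^ k + suc k * (v + d) ^ k * d)
    ≡⟨ expand k a d (v * v ^ k) ((v + d) ^ k) ⟩
      (a + d) * v ^ suc k + d * X
    ∎
    where
    open ≤-Reasoning
    expand : ∀ k a d Y Q → (a + d) * (Y + (1 + k) * Q * d) ≡ (a + d) * Y + d * ((k * (a + d) + a + d) * Q)
    expand = solve-∀
  scaled : X * a ≤ (a + d) * v ^ suc k
  scaled = subst (_≤ (a + d) * v ^ suc k) (*-comm a X)
    (+-cancelʳ-≤ (d * X) (a * X) ((a + d) * v ^ suc k)
      (subst (_≤ (a + d) * v ^ suc k + d * X) (*-distribʳ-+ X a d) bound))

-- Bernoulli's inequality in both directions, according to the sign of k y − S.
amgm-scaled : ∀ k S y → (suc k * S) ^ suc k * (k * y) ≤ S * (k * (S + y)) ^ suc k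
amgm-scaled k S y with S ≤? k * y
... | yes S≤ky = subst₂ (λ u v → (suc k * S) ^ suc k * u ≤ S * v ^ suc k) (sym ky≡S+d) (sym k[S+y]≡)
                   (amgm-scaled-large k S d)
  where
  d = k * y ∸ S
  ky≡S+d : k * y ≡ S + d
  ky≡S+d = sym (m+[n∸m]≡n S≤ky)
  k[S+y]≡ : k * (S + y) ≡ suc k * S + d
  k[S+y]≡ = trans (*-distribˡ-+ k S y) (trans (cong (k * S +_) ky≡S+d) (collect k S d))
    where collect : ∀ k S d → k * S + (S + d) ≡ (1 + k) * S + d
          collect = solve-∀
... | no S≰ky = subst (λ s → (suc k * s) ^ suc k * a ≤ s * (k * (s + y)) ^ suc k) (sym S≡a+d)
                  (subst (λ v → (suc k * (a + d)) ^ suc k * a ≤ (a + d) * v ^ suc k) (collect k y d)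
                         (amgm-scaled-small k a d))
  where
  a = k * y
  d = S ∸ a
  S≡a+d : S ≡ a + d
  S≡a+d = sym (m+[n∸m]≡n (≰⇒≥ S≰ky))
  collect : ∀ k y d → k * (k * y + d) + k * y ≡ k * (k * y + d + y)
  collect = solve-∀

amgm-step : ∀ k S y → suc k ^ suc k * y * S ^ k ≤ k ^ k * (S + y) ^ suc k
amgm-step zero S y = ≤-trans (≤-reflexive (simplify y)) (≤-trans (m≤n+m y S) (≤-reflexive (simplify′ S y)))
  where simplify : ∀ y → 1 * 1 * y * 1 ≡ y
        simplify = solve-∀
        simplify′ : ∀ S y → S + y ≡ 1 * ((S + y) * 1)
        simplify′ = solve-∀
amgm-step (suc k) zero y = ≤-trans (≤-reflexive (*-zeroʳ (suc (suc k) ^ suc (suc k) * y))) z≤n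
amgm-step (suc k) S@(suc _) y = *-cancelˡ-≤ (S * suc k) (begin
    S * suc k * (suc (suc k) ^ suc (suc k) * y * S ^ suc k)
  ≡⟨ regroup S (suc k) (suc (suc k) ^ suc (suc k)) y (S ^ suc k) ⟩
    suc (suc k) ^ suc (suc k) * (S * S ^ suc k) * (suc k * y)
  ≡⟨ cong (_* (suc k * y)) (sym (^-distribʳ-* (suc (suc k)) S (suc (suc k)))) ⟩
    (suc (suc k) * S) ^ suc (suc k) * (suc k * y)
  ≤⟨ amgm-scaled (suc k) S y ⟩
    S * (suc k * (S + y)) ^ suc (suc k)
  ≡⟨ cong (S *_) (^-distribʳ-* (suc k) (S + y) (suc (suc k))) ⟩
    S * (suc k * suc k ^ suc k * (S + y) ^ suc (suc k))
  ≡⟨ regroup′ S (suc k) (suc k ^ suc k) ((S + y) ^ suc (suc k)) ⟩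
    S * suc k * (suc k ^ suc k * (S + y) ^ suc (suc k))
  ∎)
  where
  open ≤-Reasoning
  regroup : ∀ S k A y B → S * k * (A * y * B) ≡ A * (S * B) * (k * y)
  regroup = solve-∀
  regroup′ : ∀ S k A B → S * (k * A * B) ≡ S * k * (A * B)
  regroup′ = solve-∀

amgm-weighted : ∀ p q a b → (p + q) ^ (p + q) * (a ^ p * b ^ q) ≤ (p * a + q * b) ^ (p + q)
amgm-weighted zero q a b = ≤-reflexive (trans (cong (q ^ q *_) (*-identityˡ (b ^ q))) (sym (^-distribʳ-* q b q)))
amgm-weighted (suc p) q a b = *-cancelˡ-≤ (k ^ k) {{^-self-nonZero k}} (begin
    k ^ k * (suc k ^ suc k * (a * a ^ p * b ^ q))
  ≡⟨ regroup (k ^ k) (suc k ^ suc k) a (a ^ p) (b ^ q) ⟩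
    suc k ^ suc k * a * (k ^ k * (a ^ p * b ^ q))
  ≤⟨ *-monoʳ-≤ (suc k ^ suc k * a) (amgm-weighted p q a b) ⟩
    suc k ^ suc k * a * S ^ k
  ≤⟨ amgm-step k S a ⟩
    k ^ k * (S + a) ^ suc k
  ≡⟨ cong (λ x → k ^ k * x ^ suc k) (collect p q a b) ⟩
    k ^ k * (suc p * a + q * b) ^ suc k
  ∎)
  where
  open ≤-Reasoning
  k = p + q
  S = p * a + q * b
  regroup : ∀ K A a x y → K * (A * (a * x * y)) ≡ A * a * (K * (x * y))
  regroup = solve-∀
  collect : ∀ p q a b → p * a + q * b + a ≡ (1 + p) * a + q * b
  collect = solve-∀

module KGrowth (p q : ℕ) .{{_ : NonZero q}} where
  open ProfileBound p q

  factor-bound : ∀ n → suc n ^ p * (q * suc (suc n) + p) ^ q ≤ suc (suc n) ^ p * (q * suc (suc n)) ^ q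
  factor-bound n = *-cancelˡ-≤ (q ^ p) {{m^n≢0 q p}} (*-cancelˡ-≤ ((p + q) ^ (p + q)) {{^-self-nonZero (p + q)}} (begin
      (p + q) ^ (p + q) * (q ^ p * (suc n ^ p * b ^ q))
    ≡⟨ cong ((p + q) ^ (p + q) *_) (trans (sym (*-assoc (q ^ p) _ _)) (cong (_* b ^ q) (sym (^-distribʳ-* q (suc n) p)))) ⟩
      (p + q) ^ (p + q) * ((q * suc n) ^ p * b ^ q)
    ≤⟨ amgm-weighted p q (q * suc n) b ⟩
      (p * (q * suc n) + q * b) ^ (p + q)
    ≡⟨ cong (_^ (p + q)) (collect p q n) ⟩
      ((p + q) * (q * suc (suc n))) ^ (p + q)
    ≡⟨ ^-distribʳ-* (p + q) (q * suc (suc n)) (p + q) ⟩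
      (p + q) ^ (p + q) * (q * suc (suc n)) ^ (p + q)
    ≡⟨ cong ((p + q) ^ (p + q) *_) split ⟩
      (p + q) ^ (p + q) * (q ^ p * (suc (suc n) ^ p * (q * suc (suc n)) ^ q))
    ∎))
    where
    open ≤-Reasoning
    b = q * suc (suc n) + p
    collect : ∀ p q n → p * (q * (1 + n)) + q * (q * (2 + n) + p) ≡ (p + q) * (q * (2 + n))
    collect = solve-∀
    split : (q * suc (suc n)) ^ (p + q) ≡ q ^ p * (suc (suc n) ^ p * (q * suc (suc n)) ^ q)
    split = trans (^-distribˡ-+-* (q * suc (suc n)) p q)
                  (trans (cong (_* (q * suc (suc n)) ^ q) (^-distribʳ-* q (suc (suc n)) p))
                         (*-assoc (q ^ p) _ _))

  K-bound : ∀ n → K (suc n) ^ q ≤ suc n ^ p * (suc n ! * q ^ suc n) ^ q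
  K-bound zero = ≤-reflexive (sym (trans (cong₂ _*_ (^-zeroˡ p) (cong (_^ q) (simplify q))) (*-identityˡ _)))
    where simplify : ∀ q → 1 * (q * 1) ≡ q
          simplify = solve-∀
  K-bound (suc n) = begin
      ((q * suc (suc n) + p) * K (suc n)) ^ q
    ≡⟨ ^-distribʳ-* _ _ q ⟩
      b ^ q * K (suc n) ^ q
    ≤⟨ *-monoʳ-≤ (b ^ q) (K-bound n) ⟩
      b ^ q * (suc n ^ p * F ^ q)
    ≡⟨ regroup (b ^ q) (suc n ^ p) (F ^ q) ⟩
      suc n ^ p * b ^ q * F ^ q
    ≤⟨ *-monoˡ-≤ (F ^ q) (factor-bound n) ⟩
      suc (suc n) ^ p * (q * suc (suc n)) ^ q * F ^ q
    ≡⟨ *-assoc (suc (suc n) ^ p) _ _ ⟩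
      suc (suc n) ^ p * ((q * suc (suc n)) ^ q * F ^ q)
    ≡⟨ cong (suc (suc n) ^ p *_) (sym (^-distribʳ-* (q * suc (suc n)) F q)) ⟩
      suc (suc n) ^ p * (q * suc (suc n) * F) ^ q
    ≡⟨ cong (λ z → suc (suc n) ^ p * z ^ q) (regroup′ q (suc (suc n)) (suc n !) (q ^ suc n)) ⟩
      suc (suc n) ^ p * (suc (suc n) ! * q ^ suc (suc n)) ^ q
    ∎
    where
    open ≤-Reasoning
    b = q * suc (suc n) + p
    F = suc n ! * q ^ suc n
    regroup : ∀ a b c → a * (b * c) ≡ b * a * c
    regroup = solve-∀
    regroup′ : ∀ q m f Q → q * m * (f * Q) ≡ m * f * (q * Q)
    regroup′ = solve-∀

module WeightBound (p q L M : ℕ) .{{_ : NonZero q}} .{{_ : NonZero L}} where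
  open ProfileBound p q
  open KGrowth p q

  -- Raising to the power E clears the denominators q and 100 of the exponents p/q and 441/100.
  E : ℕ
  E = q * (100 * L)

  decay : 2 * q ≤ q + p → 2 ^ M * (2 * q) ^ L ≤ (q + p) ^ L →
    ∀ k D → k * L ≤ D → 2 ^ (M * k) * (2 * q) ^ D ≤ (q + p) ^ D
  decay 2q≤q+p block≤ k D kL≤D = subst (λ D → 2 ^ (M * k) * (2 * q) ^ D ≤ (q + p) ^ D) (m∸n+n≡m kL≤D) (begin
      2 ^ (M * k) * (2 * q) ^ (r + k * L)
    ≡⟨ cong₂ _*_ (sym (^-*-assoc 2 M k)) (^-+-blocks (2 * q) r k L) ⟩
      (2 ^ M) ^ k * ((2 * q) ^ r * ((2 * q) ^ L) ^ k)
    ≡⟨ trans (*-CS.x∙yz≈y∙xz ((2 ^ M) ^ k) ((2 * q) ^ r) (((2 * q) ^ L) ^ k))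
             (cong ((2 * q) ^ r *_) (sym (^-distribʳ-* (2 ^ M) ((2 * q) ^ L) k))) ⟩
      (2 * q) ^ r * (2 ^ M * (2 * q) ^ L) ^ k
    ≤⟨ *-mono-≤ (^-monoˡ-≤ r 2q≤q+p) (^-monoˡ-≤ k block≤) ⟩
      (q + p) ^ r * ((q + p) ^ L) ^ k
    ≡⟨ sym (^-+-blocks (q + p) r k L) ⟩
      (q + p) ^ (r + k * L)
    ∎)
    where
    open ≤-Reasoning
    r = D ∸ k * L

  potential-bound : ∀ n → (suc n * suc n * K (suc n)) ^ E ≤ suc n ^ (100 * L * (2 * q + p)) * (suc n ! * q ^ suc n) ^ E
  potential-bound n = begin
      (N * N * K (suc n)) ^ E
    ≡⟨ trans (^-distribʳ-* (N * N) (K (suc n)) E) (cong (_* K (suc n) ^ E) (^-distribʳ-* N N E)) ⟩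
      N ^ E * N ^ E * K (suc n) ^ E
    ≡⟨ cong (N ^ E * N ^ E *_) (sym (^-*-assoc (K (suc n)) q (100 * L))) ⟩
      N ^ E * N ^ E * (K (suc n) ^ q) ^ (100 * L)
    ≤⟨ *-monoʳ-≤ (N ^ E * N ^ E) (^-monoˡ-≤ (100 * L) (K-bound n)) ⟩
      N ^ E * N ^ E * (N ^ p * F ^ q) ^ (100 * L)
    ≡⟨ cong (N ^ E * N ^ E *_) (trans (^-distribʳ-* (N ^ p) (F ^ q) (100 * L))
                                     (cong₂ _*_ (^-*-assoc N p (100 * L)) (^-*-assoc F q (100 * L)))) ⟩
      N ^ E * N ^ E * (N ^ (p * (100 * L)) * F ^ E)
    ≡⟨ sym (*-assoc (N ^ E * N ^ E) _ _) ⟩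
      N ^ E * N ^ E * N ^ (p * (100 * L)) * F ^ E
    ≡⟨ cong (_* F ^ E) (sym (trans (^-distribˡ-+-* N (E + E) _) (cong (_* N ^ (p * (100 * L))) (^-distribˡ-+-* N E E)))) ⟩
      N ^ (E + E + p * (100 * L)) * F ^ E
    ≡⟨ cong (λ e → N ^ e * F ^ E) (collect q p L) ⟩
      N ^ (100 * L * (2 * q + p)) * F ^ E
    ∎
    where
    open ≤-Reasoning
    N = suc n
    F = suc n ! * q ^ suc n
    collect : ∀ q p L → q * (100 * L) + q * (100 * L) + p * (100 * L) ≡ 100 * L * (2 * q + p)
    collect = solve-∀

  exponent-bound : 100 * L * (2 * q + p) ≤ 441 * M * q → ∀ n k .{{_ : NonZero n}} →
    n ^ 441 ≤ 2 ^ (k * L * 100) → n ^ (100 * L * (2 * q + p)) ≤ (2 ^ (M * k)) ^ E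
  exponent-bound e≤ n k n⁴⁴¹≤ = begin
      n ^ (100 * L * (2 * q + p))
    ≤⟨ ^-monoʳ-≤ n e≤ ⟩
      n ^ (441 * M * q)
    ≡⟨ trans (cong (n ^_) (*-assoc 441 M q)) (sym (^-*-assoc n 441 (M * q))) ⟩
      (n ^ 441) ^ (M * q)
    ≤⟨ ^-monoˡ-≤ (M * q) n⁴⁴¹≤ ⟩
      (2 ^ (k * L * 100)) ^ (M * q)
    ≡⟨ ^-*-assoc 2 (k * L * 100) (M * q) ⟩
      2 ^ (k * L * 100 * (M * q))
    ≡⟨ cong (2 ^_) (regroup M k q L) ⟩
      2 ^ (M * k * E)
    ≡⟨ sym (^-*-assoc 2 (M * k) E) ⟩
      (2 ^ (M * k)) ^ E
    ∎
    where
    open ≤-Reasoning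
    regroup : ∀ M k q L → k * L * 100 * (M * q) ≡ M * k * (q * (100 * L))
    regroup = solve-∀

  weight-bound : 2 * q ≤ q + p → 2 ^ M * (2 * q) ^ L ≤ (q + p) ^ L → 100 * L * (2 * q + p) ≤ 441 * M * q →
    ∀ n D k → k * L ≤ D → n ^ 441 ≤ 2 ^ (k * L * 100) →
    (2 * q) ^ D * (n * n * K n) ≤ (q + p) ^ D * (n ! * q ^ n)
  weight-bound _ _ _ zero D k _ _ = ≤-trans (≤-reflexive (*-zeroʳ ((2 * q) ^ D))) z≤n
  weight-bound 2q≤q+p block≤ e≤ (suc n) D k kL≤D n⁴⁴¹≤ = ^-cancelˡ-≤ E ((2 * q) ^ D * (suc n * suc n * K (suc n))) ((q + p) ^ D * F) (begin
      ((2 * q) ^ D * (suc n * suc n * K (suc n))) ^ E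
    ≡⟨ ^-distribʳ-* ((2 * q) ^ D) (suc n * suc n * K (suc n)) E ⟩
      ((2 * q) ^ D) ^ E * (suc n * suc n * K (suc n)) ^ E
    ≤⟨ *-monoʳ-≤ (((2 * q) ^ D) ^ E) (potential-bound n) ⟩
      ((2 * q) ^ D) ^ E * (suc n ^ (100 * L * (2 * q + p)) * F ^ E)
    ≤⟨ *-monoʳ-≤ (((2 * q) ^ D) ^ E) (*-monoˡ-≤ (F ^ E) (exponent-bound e≤ (suc n) k n⁴⁴¹≤)) ⟩
      ((2 * q) ^ D) ^ E * ((2 ^ (M * k)) ^ E * F ^ E)
    ≡⟨ trans (*-CS.x∙yz≈y∙xz (((2 * q) ^ D) ^ E) ((2 ^ (M * k)) ^ E) (F ^ E))
             (trans (sym (*-assoc ((2 ^ (M * k)) ^ E) (((2 * q) ^ D) ^ E) (F ^ E))) (cong (_* F ^ E) (sym (^-distribʳ-* (2 ^ (M * k)) ((2 * q) ^ D) E)))) ⟩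
      (2 ^ (M * k) * (2 * q) ^ D) ^ E * F ^ E
    ≤⟨ *-monoˡ-≤ (F ^ E) (^-monoˡ-≤ E (decay 2q≤q+p block≤ k D kL≤D)) ⟩
      ((q + p) ^ D) ^ E * F ^ E
    ≡⟨ sym (^-distribʳ-* ((q + p) ^ D) F E) ⟩
      ((q + p) ^ D * F) ^ E
    ∎)
    where
    open ≤-Reasoning
    F = suc n ! * q ^ suc n
    instance
      E≢0 : NonZero E
      E≢0 = m*n≢0 q (100 * L) {{it}} {{m*n≢0 100 L}}

2^blocks-bound : ∀ L .{{_ : NonZero L}} n m h → (2 ^ L) ^ 100 * n ^ 441 ≤ m ^ 100 → m ≤ 2 ^ suc (suc h) →
  n ^ 441 ≤ 2 ^ (suc h / L * L * 100)
2^blocks-bound L n m h c¹⁰⁰n⁴⁴¹≤m¹⁰⁰ m≤ =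
  subst (n ^ 441 ≤_) (^-*-assoc 2 (k * L) 100) (*-cancelˡ-≤ ((2 ^ L) ^ 100) {{m^n≢0 (2 ^ L) 100 {{m^n≢0 2 L}}}} (begin
    (2 ^ L) ^ 100 * n ^ 441
  ≤⟨ c¹⁰⁰n⁴⁴¹≤m¹⁰⁰ ⟩
    m ^ 100
  ≤⟨ ^-monoˡ-≤ 100 m≤ ⟩
    (2 ^ suc (suc h)) ^ 100
  ≤⟨ ^-monoˡ-≤ 100 (^-monoʳ-≤ 2 2+h≤) ⟩
    (2 ^ (L + k * L)) ^ 100
  ≡⟨ cong (_^ 100) (^-distribˡ-+-* 2 L (k * L)) ⟩
    (2 ^ L * 2 ^ (k * L)) ^ 100
  ≡⟨ ^-distribʳ-* (2 ^ L) (2 ^ (k * L)) 100 ⟩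
    (2 ^ L) ^ 100 * (2 ^ (k * L)) ^ 100
  ∎))
  where
  open ≤-Reasoning
  k = suc h / L
  2+h≤ : suc (suc h) ≤ L + k * L
  2+h≤ = ≤-trans (≤-reflexive (cong suc (m≡m%n+[m/n]*n (suc h) L))) (+-monoˡ-≤ (k * L) (m%n<n (suc h) L))

-- The binary tree algorithm

insertionPath : ℕ → BST → List Bool
insertionPath x leaf = []
insertionPath x (node l y r) = if x <ᵇ y then false ∷ insertionPath x l else true ∷ insertionPath x r

insertPath≡ : ∀ x t → insertPath x t ≡ (insertKey x t , insertionPath x t)
insertPath≡ x leaf = refl
insertPath≡ x (node l y r) with x <ᵇ y
... | true rewrite insertPath≡ x l = refl
... | false rewrite insertPath≡ x r = refl

data At : BST → List Bool → ℕ → Set where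
  here : ∀ {l v r} → At (node l v r) [] v
  left : ∀ {l v r p x} → At l p x → At (node l v r) (false ∷ p) x
  right : ∀ {l v r p x} → At r p x → At (node l v r) (true ∷ p) x

data AllKeys (P : ℕ → Set) : BST → Set where
  leaf : AllKeys P leaf
  node : ∀ {l v r} → AllKeys P l → P v → AllKeys P r → AllKeys P (node l v r)

data SearchTree : BST → Set where
  leaf : SearchTree leaf
  node : ∀ {l v r} → AllKeys (_< v) l → AllKeys (v ≤_) r → SearchTree l → SearchTree r → SearchTree (node l v r)

AllKeys-At : ∀ {P t p x} → AllKeys P t → At t p x → P x
AllKeys-At (node _ pv _) here = pv
AllKeys-At (node pl _ _) (left at) = AllKeys-At pl at
AllKeys-At (node _ _ pr) (right at) = AllKeys-At pr at

AllKeys-insertKey : ∀ {P x t} → P x → AllKeys P t → AllKeys P (insertKey x t)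
AllKeys-insertKey px leaf = node leaf px leaf
AllKeys-insertKey {x = x} px (node {v = v} pl pv pr) with x <ᵇ v
... | true = node (AllKeys-insertKey px pl) pv pr
... | false = node pl pv (AllKeys-insertKey px pr)

insertKey-SearchTree : ∀ x {t} → SearchTree t → SearchTree (insertKey x t)
insertKey-SearchTree x leaf = node leaf leaf leaf leaf
insertKey-SearchTree x (node {v = v} l<v v≤r sl sr) with x <ᵇ v in x<ᵇv
... | true = node (AllKeys-insertKey (<ᵇ≡true⇒< x<ᵇv) l<v) v≤r (insertKey-SearchTree x sl) sr
... | false = node l<v (AllKeys-insertKey (<ᵇ≡false⇒≥ x<ᵇv) v≤r) sl (insertKey-SearchTree x sr)

insertAll-SearchTree : ∀ t xs → SearchTree t → SearchTree (insertAll t xs)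
insertAll-SearchTree t [] st = st
insertAll-SearchTree t (x ∷ xs) st = insertAll-SearchTree (insertKey x t) xs (insertKey-SearchTree x st)

At-insertKey : ∀ x {t p y} → At t p y → At (insertKey x t) p y
At-insertKey x {node l v r} here with x <ᵇ v
... | true = here
... | false = here
At-insertKey x {node l v r} (left at) with x <ᵇ v
... | true = left (At-insertKey x at)
... | false = left at
At-insertKey x {node l v r} (right at) with x <ᵇ v
... | true = right at
... | false = right (At-insertKey x at)

At-insertionPath : ∀ x t → At (insertKey x t) (insertionPath x t) x
At-insertionPath x leaf = here
At-insertionPath x (node l v r) with x <ᵇ v
... | true = left (At-insertionPath x l)
... | false = right (At-insertionPath x r)

nodesAt-insertKey : ∀ d x t → nodesAt d t ≤ nodesAt d (insertKey x t)
nodesAt-insertKey d x leaf = z≤n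
nodesAt-insertKey zero x (node l v r) with x <ᵇ v
... | true = ≤-refl
... | false = ≤-refl
nodesAt-insertKey (suc d) x (node l v r) with x <ᵇ v
... | true = +-monoˡ-≤ (nodesAt d r) (nodesAt-insertKey d x l)
... | false = +-monoʳ-≤ (nodesAt d l) (nodesAt-insertKey d x r)

nodesAt-insertAll : ∀ d t xs → nodesAt d t ≤ nodesAt d (insertAll t xs)
nodesAt-insertAll d t [] = ≤-refl
nodesAt-insertAll d t (x ∷ xs) = ≤-trans (nodesAt-insertKey d x t) (nodesAt-insertAll d (insertKey x t) xs)

nodesAt-insertKey-deep : ∀ d x t → d ≤ length (insertionPath x t) → 1 ≤ nodesAt d (insertKey x t)
nodesAt-insertKey-deep zero x leaf _ = ≤-refl
nodesAt-insertKey-deep zero x (node l v r) _ with x <ᵇ v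
... | true = ≤-refl
... | false = ≤-refl
nodesAt-insertKey-deep (suc d) x (node l v r) d<len with x <ᵇ v
... | true = ≤-trans (nodesAt-insertKey-deep d x l (≤-pred d<len)) (m≤m+n _ _)
... | false = ≤-trans (nodesAt-insertKey-deep d x r (≤-pred d<len)) (m≤n+m _ _)

InOrder : ℕ → (List Bool → ℕ) → Set
InOrder h pos =
  (∀ p q → length (p ++ false ∷ q) ≤ h → pos (p ++ false ∷ q) < pos p) ×
  (∀ p q → length (p ++ true ∷ q) ≤ h → pos p < pos (p ++ true ∷ q))

InOrder-subtree : ∀ {h pos} b → InOrder (suc h) pos → InOrder h (λ p → pos (b ∷ p))
InOrder-subtree b (leftSmaller , rightLarger) =
  (λ p q len≤ → leftSmaller (b ∷ p) q (s≤s len≤)) , (λ p q len≤ → rightLarger (b ∷ p) q (s≤s len≤))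

positions-monotone : ∀ h pos → InOrder h pos → ∀ {t} → SearchTree t → ∀ {x y p p′} → At t p x → At t p′ y →
  length p ≤ h → length p′ ≤ h → x < y → pos p < pos p′
positions-monotone h pos o st here here _ _ x<y = ⊥-elim (<-irrefl refl x<y)
positions-monotone h pos o (node l<v _ _ _) here (left at′) _ _ x<y = ⊥-elim (<-asym x<y (AllKeys-At l<v at′))
positions-monotone h pos (_ , rightLarger) st here (right {p = p′} at′) _ len′ _ = rightLarger [] p′ len′
positions-monotone h pos (leftSmaller , _) st (left {p = p} at) here len _ _ = leftSmaller [] p len
positions-monotone (suc h) pos o (node _ _ sl _) (left at) (left at′) (s≤s len) (s≤s len′) x<y =
  positions-monotone h (λ p → pos (false ∷ p)) (InOrder-subtree false o) sl at at′ len len′ x<y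
positions-monotone h pos (leftSmaller , rightLarger) st (left {p = p} at) (right {p = p′} at′) len len′ _ =
  <-trans (leftSmaller [] p len) (rightLarger [] p′ len′)
positions-monotone h pos o (node _ v≤r _ _) (right at) here _ _ x<y = ⊥-elim (<⇒≱ x<y (AllKeys-At v≤r at))
positions-monotone h pos o (node l<v v≤r _ _) (right at) (left at′) _ _ x<y =
  ⊥-elim (<-asym x<y (<-≤-trans (AllKeys-At l<v at′) (AllKeys-At v≤r at)))
positions-monotone (suc h) pos o (node _ _ _ sr) (right at) (right at′) (s≤s len) (s≤s len′) x<y =
  positions-monotone h (λ p → pos (true ∷ p)) (InOrder-subtree true o) sr at at′ len len′ x<y

isInv-monotone : ∀ x a y b → (x < y → a < b) → (y < x → b < a) → isInv (x , a) (y , b) ≡ false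
isInv-monotone x a y b mono mono′ with x <? y
... | yes x<y rewrite <⇒<ᵇ≡true x<y | ≥⇒<ᵇ≡false (<⇒≤ (mono x<y)) | ≥⇒<ᵇ≡false (<⇒≤ x<y) = refl
... | no x≮y rewrite ≥⇒<ᵇ≡false (≮⇒≥ x≮y) with y <? x
...   | yes y<x rewrite <⇒<ᵇ≡true y<x | ≥⇒<ᵇ≡false (<⇒≤ (mono′ y<x)) = refl
...   | no y≮x rewrite ≥⇒<ᵇ≡false (≮⇒≥ y≮x) = refl

module _ (h : ℕ) (pos : List Bool → ℕ) (o : InOrder h pos) where

  Shallow : List Bool → Set
  Shallow p = length p ≤ h

  countInv-stored : ∀ {t} → SearchTree t → ∀ {x q} → At t q x → Shallow q →
    ∀ {ys qs} → Pointwise (λ y q′ → At t q′ y) ys qs → All Shallow qs →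
    countInv (x , pos q) (zip ys (map pos qs)) ≡ 0
  countInv-stored st at sh [] [] = refl
  countInv-stored st {x} {q} at sh {y ∷ _} {q′ ∷ _} (at′ ∷ ats) (sh′ ∷ shs)
    rewrite isInv-monotone x (pos q) y (pos q′) (positions-monotone h pos o st at at′ sh sh′)
                                                (positions-monotone h pos o st at′ at sh′ sh) =
    countInv-stored st at sh ats shs

  inversions-stored : ∀ {t} → SearchTree t → ∀ {xs qs} → Pointwise (λ x q → At t q x) xs qs → All Shallow qs →
    inversions (zip xs (map pos qs)) ≡ 0
  inversions-stored st [] [] = refl
  inversions-stored st (at ∷ ats) (sh ∷ shs) rewrite countInv-stored st at sh ats shs = inversions-stored st ats shs

  runBT-shallow : ∀ (F : Fallback) xs t arr qs → SearchTree t → Pointwise (λ x q → At t q x) arr qs → All Shallow qs →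
    nodesAt (suc h) (insertAll t xs) ≡ 0 →
    Σ (List (List Bool)) λ qs′ → (runBT h pos F t false arr (map pos qs) xs ≡ map pos qs′) ×
      Pointwise (λ x q → At (insertAll t xs) q x) (arr ++ xs) qs′ × All Shallow qs′
  runBT-shallow F [] t arr qs st ats shs _ = qs , refl , subst (λ a → Pointwise _ a qs) (sym (++-identityʳ arr)) ats , shs
  runBT-shallow F (x ∷ xs) t arr qs st ats shs noDeep rewrite insertPath≡ x t
    with length (insertionPath x t) ≤ᵇ h in fits
  ... | true with runBT-shallow F xs (insertKey x t) (arr ++ [ x ]) (qs ++ [ insertionPath x t ])
                   (insertKey-SearchTree x st)
                   (Pointwise.++⁺ (Pointwise.map (At-insertKey x) ats) (At-insertionPath x t ∷ []))
                   (++⁺ shs (≤ᵇ⇒≤ _ _ (subst T (sym fits) tt) ∷ [])) noDeep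
  ...   | qs′ , run≡ , ats′ , shs′ =
          qs′ , trans (cong (λ ps → runBT h pos F (insertKey x t) false (arr ++ [ x ]) ps xs) (sym (map-++ pos qs _))) run≡ ,
          subst (λ a → Pointwise _ a qs′) (++-assoc arr [ x ] xs) ats′ , shs′
  runBT-shallow F (x ∷ xs) t arr qs st ats shs noDeep | false =
    ⊥-elim (<⇒≱ (nodesAt-insertKey-deep (suc h) x t (≰⇒> (λ len≤h → subst T fits (≤⇒≤ᵇ len≤h))))
                (≤-trans (nodesAt-insertAll (suc h) (insertKey x t) xs) (≤-reflexive noDeep)))

countInv≤length : ∀ a bs → countInv a bs ≤ length bs
countInv≤length a [] = z≤n
countInv≤length a (b ∷ bs) with isInv a b
... | true = s≤s (countInv≤length a bs)
... | false = m≤n⇒m≤1+n (countInv≤length a bs)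

inversions≤length² : ∀ as → inversions as ≤ length as * length as
inversions≤length² [] = z≤n
inversions≤length² (a ∷ as) = ≤-trans (+-mono-≤ (countInv≤length a as) (inversions≤length² as))
  (+-mono-≤ (n≤1+n (length as)) (*-monoʳ-≤ (length as) (n≤1+n (length as))))

inversions-bound : ∀ h pos F → InOrder h pos → ∀ σ →
  inversions (binaryTreeAlg h pos F σ) ≤ length σ * length σ * nodesAt (suc h) (bst σ)
inversions-bound h pos F o σ with nodesAt (suc h) (bst σ) in noDeep
... | zero with runBT-shallow h pos o F σ leaf [] [] leaf [] [] noDeep
...   | qs , run≡ , ats , shs = ≤-reflexive (begin
          inversions (zip σ (runBT h pos F leaf false [] [] σ))
        ≡⟨ cong (inversions ∘ zip σ) run≡ ⟩
          inversions (zip σ (map pos qs))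
        ≡⟨ inversions-stored h pos o (insertAll-SearchTree leaf σ leaf) ats shs ⟩
          0
        ≡⟨ sym (*-zeroʳ (length σ * length σ)) ⟩
          length σ * length σ * 0
        ∎)
  where open ≡-Reasoning
inversions-bound h pos F o σ | suc k =
  ≤-trans (inversions≤length² (zip σ R)) (≤-trans (*-mono-≤ zip≤ zip≤) (m≤m*n _ (suc k)))
  where
  R = runBT h pos F leaf false [] [] σ
  zip≤ : length (zip σ R) ≤ length σ
  zip≤ = ≤-trans (≤-reflexive (length-zipWith _,_ σ R)) (m⊓n≤m _ _)

totalInversions-bound : ∀ n h pos F → InOrder h pos → totalInversions n h pos F ≤ n * n * profile n (suc h)
totalInversions-bound n h pos F o = begin
    sumPerms n (λ σ → inversions (binaryTreeAlg h pos F σ))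
  ≤⟨ sumPerms-mono n _ _ (λ σ (len , _) →
       subst (λ ℓ → inversions (binaryTreeAlg h pos F σ) ≤ ℓ * ℓ * nodesAt (suc h) (bst σ)) len
             (inversions-bound h pos F o σ)) ⟩
    sumPerms n (λ σ → n * n * nodesAt (suc h) (bst σ))
  ≡⟨ sumOf-* (n * n) _ (perms n) ⟩
    n * n * profile n (suc h)
  ∎
  where open ≤-Reasoning

module _ (p q L M : ℕ) .{{_ : NonZero q}} .{{_ : NonZero L}} where
  open ProfileBound p q
  open WeightBound p q L M

  totalInversions≤n! : 2 * q ≤ q + p → 2 ^ M * (2 * q) ^ L ≤ (q + p) ^ L → 100 * L * (2 * q + p) ≤ 441 * M * q →
    ∀ n m h pos F → (2 ^ L) ^ 100 * n ^ 441 ≤ m ^ 100 → m ≤ 2 ^ suc (suc h) → InOrder h pos →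
    totalInversions n h pos F ≤ n !
  totalInversions≤n! 2q≤q+p block≤ e≤ n m h pos F c¹⁰⁰n⁴⁴¹≤m¹⁰⁰ m≤ o =
    ≤-trans (totalInversions-bound n h pos F o) (*-cancelʳ-≤ _ (n !) ((q + p) ^ suc h * q ^ n) {{Z≢0}} (begin
      n * n * profile n (suc h) * ((q + p) ^ suc h * q ^ n)
    ≡⟨ *-assoc (n * n) (profile n (suc h)) _ ⟩
      n * n * (profile n (suc h) * ((q + p) ^ suc h * q ^ n))
    ≤⟨ *-monoʳ-≤ (n * n) (profile-bound (suc h) n) ⟩
      n * n * ((2 * q) ^ suc h * K n)
    ≡⟨ *-CS.x∙yz≈y∙xz (n * n) ((2 * q) ^ suc h) (K n) ⟩
      (2 * q) ^ suc h * (n * n * K n)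
    ≤⟨ weight-bound 2q≤q+p block≤ e≤ n (suc h) (suc h / L) (m/n*n≤m (suc h) L)
                    (2^blocks-bound L n m h c¹⁰⁰n⁴⁴¹≤m¹⁰⁰ m≤) ⟩
      (q + p) ^ suc h * (n ! * q ^ n)
    ≡⟨ *-CS.x∙yz≈y∙xz ((q + p) ^ suc h) (n !) (q ^ n) ⟩
      n ! * ((q + p) ^ suc h * q ^ n)
    ∎))
    where
    open ≤-Reasoning
    Z≢0 : NonZero ((q + p) ^ suc h * q ^ n)
    Z≢0 = m*n≢0 _ _ {{m^n≢0 (q + p) (suc h) {{>-nonZero (<-≤-trans (>-nonZero⁻¹ q) (m≤m+n q p))}}}} {{m^n≢0 q n}}

-- Writing c as 2 ^ 3 rather than 8 keeps c ^ 100 syntactically equal to (2 ^ L) ^ 100; otherwise the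
-- type checker unfolds the huge literal. For p/q = 107/20 and M/L = 5/3 the side conditions read
-- 40 ≤ 127, 2^5 · 40^3 ≤ 127^3 and 44100 ≤ 44100.
corollary4p2 : Σ ℕ λ c → (1 ≤ c) × Σ ℕ λ C →
    ∀ (n m h : ℕ) (pos : List Bool → ℕ) (F : Fallback) →
    c ^ 100 * n ^ 441 ≤ m ^ 100 →
    2 ^ (h + 1) ∸ 1 ≤ m → m < 2 ^ (h + 2) ∸ 1 →
    ValidTreePositions m h pos → ValidFallback m F →
    totalInversions n h pos F ≤ C * (n !)
corollary4p2 = 2 ^ 3 , s≤s z≤n , 1 , λ n m h pos F c¹⁰⁰n⁴⁴¹≤m¹⁰⁰ _ m<2^[h+2]∸1 (_ , inOrder) _ →
  ≤-trans (totalInversions≤n! 107 20 3 5 (≤ᵇ⇒≤ 40 127 tt) (≤ᵇ⇒≤ (2 ^ 5 * 40 ^ 3) (127 ^ 3) tt) ≤-refl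
             n m h pos F c¹⁰⁰n⁴⁴¹≤m¹⁰⁰ (m≤2^[2+h] m h m<2^[h+2]∸1) inOrder)
          (≤-reflexive (sym (*-identityˡ (n !))))
  where
  m≤2^[2+h] : ∀ m h → m < 2 ^ (h + 2) ∸ 1 → m ≤ 2 ^ suc (suc h)
  m≤2^[2+h] m h m< = ≤-trans (<⇒≤ m<) (≤-trans (m∸n≤m _ 1) (≤-reflexive (cong (2 ^_) (+-comm h 2))))
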